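{- Let $G$ be a graph with $G\neq K_4$ such that $K_4$ is a base of $G$. Then for every triangle $T$ in $G$, the graph $G/T$ obtained by contracting $V(T)$ to a single vertex is a cubic brick.
   Context: Graphs are finite, loopless, multiple edges allowed. For a vertex $x$ of degree 3 with neighbours $y_1,y_2,y_3$, a $Y\rightarrow\triangle$-operation on $x$ replaces $x$ by a triangle $x_1x_2x_3x_1$ and joins $x_i$ to $y_i$ for $i=1,2,3$. A graph $H$ is a base of $G$ if $G$ can be obtained from $H$ by a (nonempty) series of $Y\rightarrow\triangle$-operations. A brick is a 3-connected bicritical graph (a graph on at least four vertices is bicritical if $G-u-v$ has a perfect matching for all distinct $u,v$). -}

module Defs where

open import Data.Nat using (ℕ; zero; suc; _+_; _≤_; _<_)
open import Data.Fin using (Fin; zero; suc; splitAt; _≟_)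
open import Data.Fin.Subset using (Subset; _∉_; ∣_∣)
open import Data.List using (List; map; allFin)
open import Data.Nat.ListAction using (sum)
open import Data.Sum using (_⊎_; inj₁; inj₂)
open import Data.Product using (Σ; _×_; _,_; ∃)
open import Relation.Nullary using (¬_; Dec; yes; no)
open import Relation.Binary.PropositionalEquality using (_≡_; _≢_)
open import Function.Bundles using (_↔_; Inverse)
open import Function.Definitions using (Surjective)

-- Finite loopless multigraphs, given by an edge-multiplicity function:
-- mult u v = number of parallel edges between u and v.

record Graph : Set where
  constructor graph
  field
    size : ℕ
    mult : Fin size → Fin size → ℕ
open Graph public

record IsGraph (G : Graph) : Set where
  field
    symmetric : ∀ u v → mult G u v ≡ mult G v u
    loopless  : ∀ v → mult G v v ≡ 0

Σfin : (n : ℕ) → (Fin n → ℕ) → ℕ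
Σfin n f = sum (map f (allFin n))

ind : ∀ {A : Set} → Dec A → ℕ
ind (yes _) = 1
ind (no _)  = 0

nind : ∀ {A : Set} → Dec A → ℕ
nind (yes _) = 0
nind (no _)  = 1

degree : (G : Graph) → Fin (size G) → ℕ
degree G v = Σfin (size G) (λ u → mult G v u)

Cubic : Graph → Set
Cubic G = ∀ v → degree G v ≡ 3

Adjacent : (G : Graph) → Fin (size G) → Fin (size G) → Set
Adjacent G u v = 1 ≤ mult G u v

_≅_ : Graph → Graph → Set
G ≅ H = Σ (Fin (size G) ↔ Fin (size H)) λ σ →
          ∀ u v → mult H (Inverse.to σ u) (Inverse.to σ v) ≡ mult G u v

K4 : Graph
K4 = graph 4 (λ u v → nind (u ≟ v))

-- Y → Δ operation.
-- y : Fin 3 → Fin n lists the three neighbours y₁,y₂,y₃ of x (with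
-- repetition, to allow parallel edges); "x has degree 3 with neighbours
-- y₁,y₂,y₃" means mult x v = #{ i | y i ≡ v } for every v.

countY : ∀ {n} → (Fin 3 → Fin n) → Fin n → ℕ
countY y v = ind (y zero ≟ v) + ind (y (suc zero) ≟ v) + ind (y (suc (suc zero)) ≟ v)

Nbrs : (G : Graph) → Fin (size G) → (Fin 3 → Fin (size G)) → Set
Nbrs G x y = ∀ v → mult G x v ≡ countY y v

-- vertices of the new graph on Fin (n + 2): the old vertices other than x,
-- and the triangle vertices x₁ (= old x), x₂, x₃ (= the two new ones)
data Role (n : ℕ) : Set where
  old : Fin n → Role n
  tri : Fin 3 → Role n

role : ∀ {n} → Fin n → Fin (n + 2) → Role n
role {n} x v with splitAt n v
... | inj₂ j = tri (suc j)
... | inj₁ a with a ≟ x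
...   | yes _ = tri zero
...   | no _  = old a

roleMult : (G : Graph) → (Fin 3 → Fin (size G)) → Role (size G) → Role (size G) → ℕ
roleMult G y (old a) (old b) = mult G a b
roleMult G y (old a) (tri i) = ind (y i ≟ a)
roleMult G y (tri i) (old b) = ind (y i ≟ b)
roleMult G y (tri i) (tri j) = nind (i ≟ j)

YΔ : (G : Graph) → Fin (size G) → (Fin 3 → Fin (size G)) → Graph
YΔ G x y = graph (size G + 2) (λ u v → roleMult G y (role x u) (role x v))

data YΔ⁺ (H : Graph) : Graph → Set where
  one  : ∀ x y → Nbrs H x y → YΔ⁺ H (YΔ H x y)
  more : ∀ {G} x y → YΔ⁺ H G → Nbrs G x y → YΔ⁺ H (YΔ G x y)

IsBase : Graph → Graph → Set
IsBase H G = Σ Graph λ G' → YΔ⁺ H G' × (G ≅ G')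

record Triangle (G : Graph) : Set where
  constructor triangle
  field
    a b c : Fin (size G)
    a≢b : a ≢ b
    b≢c : b ≢ c
    a≢c : a ≢ c
    ab : Adjacent G a b
    bc : Adjacent G b c
    ac : Adjacent G a c

InT : ∀ {G} → Triangle G → Fin (size G) → Set
InT T u = u ≡ Triangle.a T ⊎ u ≡ Triangle.b T ⊎ u ≡ Triangle.c T

-- H is (a copy of) G/T: f : V(G) → V(H) is onto, identifies exactly the
-- three vertices of T, edges inside T are deleted, and every other edge of
-- G is kept (parallel edges included).
record Contraction (G : Graph) (T : Triangle G) (H : Graph) : Set where
  field
    f       : Fin (size G) → Fin (size H)
    onto    : Surjective _≡_ _≡_ f
    fibres  : ∀ u v → (f u ≡ f v → u ≡ v ⊎ (InT T u × InT T v))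
                    × (u ≡ v ⊎ (InT T u × InT T v) → f u ≡ f v)
    edges   : ∀ p q → p ≢ q →
              mult H p q ≡ Σfin (size G) (λ u → Σfin (size G) (λ v →
                 ind (f u ≟ p) Data.Nat.* ind (f v ≟ q) Data.Nat.* mult G u v))
    noLoops : ∀ p → mult H p p ≡ 0

data WalkAvoid (G : Graph) (X : Subset (size G)) : Fin (size G) → Fin (size G) → Set where
  here : ∀ {u} → WalkAvoid G X u u
  step : ∀ {u w v} → Adjacent G u w → w ∉ X → WalkAvoid G X w v → WalkAvoid G X u v

ConnectedMinus : (G : Graph) → Subset (size G) → Set
ConnectedMinus G X = ∀ u v → u ∉ X → v ∉ X → WalkAvoid G X u v

ThreeConnected : Graph → Set
ThreeConnected G = 4 ≤ size G × (∀ (X : Subset (size G)) → ∣ X ∣ < 3 → ConnectedMinus G X)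

-- G - s - t has a perfect matching, given by the partner function p
PMMinus2 : (G : Graph) → Fin (size G) → Fin (size G) → Set
PMMinus2 G s t = Σ (Fin (size G) → Fin (size G)) λ p →
  ∀ w → w ≢ s → w ≢ t →
    (p w ≢ s) × (p w ≢ t) × (p w ≢ w) × (p (p w) ≡ w) × Adjacent G w (p w)

Bicritical : Graph → Set
Bicritical G = 4 ≤ size G × (∀ s t → s ≢ t → PMMinus2 G s t)

Brick : Graph → Set
Brick G = ThreeConnected G × Bicritical G

-- Every graph obtained from K4 by Y→Δ-operations is cubic, simple and a brick, and has no diamond
-- (no vertex outside a triangle is adjacent to two of its vertices); we carry along the chain the
-- stronger invariant that, moreover, every triangle contracts to a cubic brick. After a Y→Δ-operation
-- on x a triangle is either the new one, whose contraction is the previous graph, or a triangle T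
-- avoiding x; then the contraction by T is obtained from G/T by the Y→Δ-operation on the image of x.
-- That operation preserves cubic bricks as long as the three neighbours stay distinct, which holds in
-- G/T because G has no diamond. In the first step G = K4, where K4/T is a triple edge and expanding
-- it gives back K4. Finally G/T is unique up to isomorphism, and cubic bricks are closed under it.

module Submission where

open import Defs
open import Data.Nat using (ℕ; zero; suc; _+_; _*_; _≤_; _<_; z≤n; s≤s)
open import Data.Nat.Properties hiding (_≟_; suc-injective)
open import Data.Nat.ListAction using (sum)
open import Data.Nat.Solver using (module +-*-Solver)
open import Data.Fin using (Fin; zero; suc; _≟_; _↑ˡ_; _↑ʳ_; splitAt; join; punchIn; punchOut)
open import Data.Fin.Properties
  using (suc-injective; splitAt-↑ˡ; splitAt-↑ʳ; join-splitAt; punchInᵢ≢i; punchIn-injective; punchIn-punchOut; all?)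
open import Data.Fin.Subset using (Subset; _∈_; _∉_; ∣_∣; _-_; Empty)
open import Data.Fin.Subset.Properties using (nonempty?; x∈p⇒∣p-x∣<∣p∣; x∈p∧x≢y⇒x∈p-y; p─q⊆p)
import Data.Fin.Permutation as Perm
open import Data.List.Properties using (map-tabulate)
open import Data.Empty using (⊥; ⊥-elim)
open import Data.Unit using (⊤; tt)
open import Data.Sum using (_⊎_; inj₁; inj₂; [_,_]′)
import Data.Sum as Sum
open import Data.Product using (Σ; _×_; _,_; proj₁; proj₂; ∃-syntax)
import Data.Product as Product
open import Function using (_∘_)
open import Function.Bundles using (_↔_; Inverse; mk↔ₛ′)
open import Relation.Nullary using (¬_; Dec; yes; no; contradiction)
open import Relation.Nullary.Decidable using (map′; ¬?; _×-dec_; _⊎-dec_; _→-dec_; toWitness)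
open import Relation.Binary.PropositionalEquality
import Algebra.Properties.Semiring.Sum as SemiringSum

open +-*-Solver using (solve; _:+_; _:*_; _:=_; con)

module ∑ = SemiringSum +-*-semiring

Σfin-suc : ∀ n (f : Fin (suc n) → ℕ) → Σfin (suc n) f ≡ f zero + Σfin n (λ i → f (suc i))
Σfin-suc n f = cong (λ l → f zero + sum l)
  (trans (map-tabulate suc f) (sym (map-tabulate (λ i → i) (λ i → f (suc i)))))

Σfin≡∑ : ∀ n (f : Fin n → ℕ) → Σfin n f ≡ ∑.sum f
Σfin≡∑ zero    f = refl
Σfin≡∑ (suc n) f = trans (Σfin-suc n f) (cong (f zero +_) (Σfin≡∑ n (λ i → f (suc i))))

Σfin-cong : ∀ n {f g : Fin n → ℕ} → (∀ i → f i ≡ g i) → Σfin n f ≡ Σfin n g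
Σfin-cong n {f} {g} f≗g = trans (Σfin≡∑ n f) (trans (∑.sum-cong-≗ f≗g) (sym (Σfin≡∑ n g)))

Σfin-distrib-+ : ∀ n (f g : Fin n → ℕ) → Σfin n (λ i → f i + g i) ≡ Σfin n f + Σfin n g
Σfin-distrib-+ n f g = trans (Σfin≡∑ n _)
  (trans (∑.∑-distrib-+ f g) (sym (cong₂ _+_ (Σfin≡∑ n f) (Σfin≡∑ n g))))

Σfin-*ˡ : ∀ n c (f : Fin n → ℕ) → Σfin n (λ i → c * f i) ≡ c * Σfin n f
Σfin-*ˡ n c f = trans (Σfin≡∑ n _)
  (trans (sym (∑.*-distribˡ-sum c f)) (cong (c *_) (sym (Σfin≡∑ n f))))

Σfin-comm : ∀ n m (h : Fin n → Fin m → ℕ) →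
  Σfin n (λ i → Σfin m (h i)) ≡ Σfin m (λ j → Σfin n (λ i → h i j))
Σfin-comm n m h = begin
  Σfin n (λ i → Σfin m (h i))         ≡⟨ Σfin-cong n (λ i → Σfin≡∑ m (h i)) ⟩
  Σfin n (λ i → ∑.sum (h i))          ≡⟨ Σfin≡∑ n _ ⟩
  ∑.sum (λ i → ∑.sum (h i))           ≡⟨ ∑.∑-comm h ⟩
  ∑.sum (λ j → ∑.sum (λ i → h i j))   ≡⟨ sym (Σfin≡∑ m _) ⟩
  Σfin m (λ j → ∑.sum (λ i → h i j))  ≡⟨ Σfin-cong m (λ j → sym (Σfin≡∑ n (λ i → h i j))) ⟩
  Σfin m (λ j → Σfin n (λ i → h i j)) ∎
  where open ≡-Reasoning

Σfin-permute : ∀ n m (π : Fin n ↔ Fin m) (h : Fin m → ℕ) →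
  Σfin n (λ u → h (Inverse.to π u)) ≡ Σfin m h
Σfin-permute n m π h = trans (Σfin≡∑ n _) (trans (sym (∑.sum-permute h π)) (sym (Σfin≡∑ m h)))

∑-↑ : ∀ n k (f : Fin (n + k) → ℕ) → ∑.sum f ≡ ∑.sum (λ i → f (i ↑ˡ k)) + ∑.sum (λ j → f (n ↑ʳ j))
∑-↑ zero    k f = refl
∑-↑ (suc n) k f = trans (cong (f zero +_) (∑-↑ n k (λ i → f (suc i)))) (sym (+-assoc (f zero) _ _))

Σfin-↑ : ∀ n k (f : Fin (n + k) → ℕ) → Σfin (n + k) f ≡ Σfin n (λ i → f (i ↑ˡ k)) + Σfin k (λ j → f (n ↑ʳ j))
Σfin-↑ n k f = trans (Σfin≡∑ (n + k) f)
  (trans (∑-↑ n k f) (sym (cong₂ _+_ (Σfin≡∑ n _) (Σfin≡∑ k _))))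

ind-cong : ∀ {A B : Set} (a? : Dec A) (b? : Dec B) → (A → B) → (B → A) → ind a? ≡ ind b?
ind-cong (yes a) (yes b) f g = refl
ind-cong (yes a) (no ¬b) f g = contradiction (f a) ¬b
ind-cong (no ¬a) (yes b) f g = contradiction (g b) ¬a
ind-cong (no ¬a) (no ¬b) f g = refl

nind-cong : ∀ {A B : Set} (a? : Dec A) (b? : Dec B) → (A → B) → (B → A) → nind a? ≡ nind b?
nind-cong (yes a) (yes b) f g = refl
nind-cong (yes a) (no ¬b) f g = contradiction (f a) ¬b
nind-cong (no ¬a) (yes b) f g = contradiction (g b) ¬a
nind-cong (no ¬a) (no ¬b) f g = refl

ind-yes : ∀ {A : Set} (a? : Dec A) → A → ind a? ≡ 1
ind-yes (yes _) _ = refl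
ind-yes (no ¬a) a = contradiction a ¬a

ind-no : ∀ {A : Set} (a? : Dec A) → ¬ A → ind a? ≡ 0
ind-no (yes a) ¬a = contradiction a ¬a
ind-no (no _)  _  = refl

nind-yes : ∀ {A : Set} (a? : Dec A) → A → nind a? ≡ 0
nind-yes (yes _) _ = refl
nind-yes (no ¬a) a = contradiction a ¬a

nind-no : ∀ {A : Set} (a? : Dec A) → ¬ A → nind a? ≡ 1
nind-no (yes a) ¬a = contradiction a ¬a
nind-no (no _)  _  = refl

ind≤1 : ∀ {A : Set} (a? : Dec A) → ind a? ≤ 1
ind≤1 (yes _) = s≤s z≤n
ind≤1 (no _)  = z≤n

nind≤1 : ∀ {A : Set} (a? : Dec A) → nind a? ≤ 1
nind≤1 (yes _) = z≤n
nind≤1 (no _)  = s≤s z≤n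

ind-positive : ∀ {A : Set} (a? : Dec A) → 1 ≤ ind a? → A
ind-positive (yes a) _ = a

Σfin-ind : ∀ n (a : Fin n) (h : Fin n → ℕ) → Σfin n (λ u → ind (u ≟ a) * h u) ≡ h a
Σfin-ind n a h = trans (Σfin≡∑ n _) (go n a h)
  where
  go : ∀ n (a : Fin n) (h : Fin n → ℕ) → ∑.sum (λ u → ind (u ≟ a) * h u) ≡ h a
  go (suc n) zero h
    rewrite ∑.sum-cong-≗ (λ i → cong (_* h (suc i)) (ind-no (suc i ≟ zero) λ ()))
          | ∑.sum-replicate-zero n = trans (+-identityʳ _) (*-identityˡ (h zero))
  go (suc n) (suc a) h
    rewrite ∑.sum-cong-≗ (λ i → cong (_* h (suc i)) (ind-cong (suc i ≟ suc a) (i ≟ a) suc-injective (cong suc)))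
    = go n a (λ i → h (suc i))

ind-sym : ∀ {n} (a b : Fin n) → ind (a ≟ b) ≡ ind (b ≟ a)
ind-sym a b = ind-cong (a ≟ b) (b ≟ a) sym sym

Σfin-ind-sym : ∀ n (a : Fin n) → Σfin n (λ u → ind (a ≟ u)) ≡ 1
Σfin-ind-sym n a = trans (Σfin-cong n (λ u → trans (ind-sym a u) (sym (*-identityʳ _)))) (Σfin-ind n a (λ _ → 1))

ifDec : ∀ {A P : Set} → Dec P → A → A → A
ifDec (yes _) a b = a
ifDec (no _)  a b = b

ifDec-yes : ∀ {A P : Set} (p? : Dec P) {a b : A} → P → ifDec p? a b ≡ a
ifDec-yes (yes _) _ = refl
ifDec-yes (no ¬p) p = contradiction p ¬p

ifDec-no : ∀ {A P : Set} (p? : Dec P) {a b : A} → ¬ P → ifDec p? a b ≡ b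
ifDec-no (yes p) ¬p = contradiction p ¬p
ifDec-no (no _)  _  = refl

Σfin²-factor : ∀ n m (A : Fin n → ℕ) (B : Fin m → ℕ) (M : Fin n → Fin m → ℕ) →
  Σfin n (λ u → Σfin m (λ v → A u * B v * M u v)) ≡ Σfin n (λ u → A u * Σfin m (λ v → B v * M u v))
Σfin²-factor n m A B M = Σfin-cong n λ u →
  trans (Σfin-cong m (λ v → *-assoc (A u) (B v) (M u v))) (Σfin-*ˡ m (A u) (λ v → B v * M u v))

data WalkMinus₂ (G : Graph) (a b : Fin (size G)) : Fin (size G) → Fin (size G) → Set where
  here : ∀ {u} → WalkMinus₂ G a b u u
  step : ∀ {u w v} → Adjacent G u w → w ≢ a → w ≢ b → WalkMinus₂ G a b w v → WalkMinus₂ G a b u v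

ConnectedMinus₂ : Graph → Set
ConnectedMinus₂ G = ∀ a b u v → u ≢ a → u ≢ b → v ≢ a → v ≢ b → WalkMinus₂ G a b u v

Brick′ : Graph → Set
Brick′ G = ConnectedMinus₂ G × Bicritical G

Simple : Graph → Set
Simple G = ∀ u v → mult G u v ≤ 1

∣p∣<1⇒Empty : ∀ {n} (X : Subset n) → ∣ X ∣ < 1 → Empty X
∣p∣<1⇒Empty X (s≤s ∣X∣≤0) (a , a∈X) = n≮0 (≤-trans (x∈p⇒∣p-x∣<∣p∣ a∈X) ∣X∣≤0)

x∈p⇒x≡y⊎x∈p-y : ∀ {n} {X : Subset n} (a : Fin n) {w} → w ∈ X → w ≡ a ⊎ w ∈ X - a
x∈p⇒x≡y⊎x∈p-y a {w} w∈X with w ≟ a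
... | yes w≡a = inj₁ w≡a
... | no  w≢a = inj₂ (x∈p∧x≢y⇒x∈p-y w∈X w≢a)

-- c is the default vertex used when X has fewer than two elements.
cover₂ : ∀ {n} (X : Subset n) → ∣ X ∣ < 3 → (c : Fin n) →
  ∃[ a ] ∃[ b ] (a ≡ c ⊎ a ∈ X) × (b ≡ c ⊎ b ∈ X) × (∀ w → w ∈ X → w ≡ a ⊎ w ≡ b)
cover₂ X ∣X∣<3 c with nonempty? X
... | no ¬ne = c , c , inj₁ refl , inj₁ refl , λ w w∈X → contradiction (w , w∈X) ¬ne
... | yes (a , a∈X) with nonempty? (X - a)
...   | no ¬ne = a , a , inj₂ a∈X , inj₂ a∈X ,
          λ w w∈X → [ inj₁ , (λ w∈X-a → contradiction (w , w∈X-a) ¬ne) ]′ (x∈p⇒x≡y⊎x∈p-y a w∈X)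
...   | yes (b , b∈X-a) = a , b , inj₂ a∈X , inj₂ (p─q⊆p _ _ b∈X-a) , cover
  where
  ∣X-a-b∣<1 : ∣ (X - a) - b ∣ < 1
  ∣X-a-b∣<1 = ≤-pred (≤-pred (≤-trans (s≤s (≤-trans (s≤s (x∈p⇒∣p-x∣<∣p∣ b∈X-a)) (x∈p⇒∣p-x∣<∣p∣ a∈X))) ∣X∣<3))
  cover : ∀ w → w ∈ X → w ≡ a ⊎ w ≡ b
  cover w w∈X with x∈p⇒x≡y⊎x∈p-y a w∈X
  ... | inj₁ w≡a = inj₁ w≡a
  ... | inj₂ w∈X-a with x∈p⇒x≡y⊎x∈p-y b w∈X-a
  ...   | inj₁ w≡b = inj₂ w≡b
  ...   | inj₂ w∈X-a-b = contradiction (w , w∈X-a-b) (∣p∣<1⇒Empty _ ∣X-a-b∣<1)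

avoiding₂ : ∀ {n} (u v : Fin (suc (suc (suc n)))) → ∃[ c ] u ≢ c × v ≢ c
avoiding₂ u v with u ≟ v
... | yes refl = punchIn u zero , (λ e → punchInᵢ≢i u zero (sym e)) , (λ e → punchInᵢ≢i u zero (sym e))
... | no u≢v = punchIn u k , (λ e → punchInᵢ≢i u k (sym e)) , v≢c
  where
  j = punchOut u≢v
  k = punchIn j zero
  v≢c : v ≢ punchIn u k
  v≢c e = punchInᵢ≢i j zero (sym (punchIn-injective u j k (trans (punchIn-punchOut u≢v) e)))

walkMinus₂⇒walkAvoid : ∀ {G X a b} → (∀ w → w ∈ X → w ≡ a ⊎ w ≡ b) →
  ∀ {u v} → WalkMinus₂ G a b u v → WalkAvoid G X u v
walkMinus₂⇒walkAvoid X⊆ab here = here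
walkMinus₂⇒walkAvoid X⊆ab (step adj w≢a w≢b p) =
  step adj (λ w∈X → [ w≢a , w≢b ]′ (X⊆ab _ w∈X)) (walkMinus₂⇒walkAvoid X⊆ab p)

connectedMinus₂⇒threeConnected : ∀ G → 4 ≤ size G → ConnectedMinus₂ G → ThreeConnected G
connectedMinus₂⇒threeConnected G@(graph _ _) 4≤n@(s≤s (s≤s (s≤s _))) conn = 4≤n , connected
  where
  connected : ∀ X → ∣ X ∣ < 3 → ConnectedMinus G X
  connected X ∣X∣<3 u v u∉X v∉X
    with c , u≢c , v≢c ← avoiding₂ u v
    with a , b , a∈ , b∈ , X⊆ab ← cover₂ X ∣X∣<3 c =
    walkMinus₂⇒walkAvoid X⊆ab (conn a b u v (≢ u∉X u≢c a∈) (≢ u∉X u≢c b∈) (≢ v∉X v≢c a∈) (≢ v∉X v≢c b∈))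
    where
    ≢ : ∀ {w z} → w ∉ X → w ≢ c → z ≡ c ⊎ z ∈ X → w ≢ z
    ≢ w∉X w≢c (inj₁ refl) = w≢c
    ≢ w∉X w≢c (inj₂ z∈X) refl = w∉X z∈X

brick′⇒brick : ∀ G → Brick′ G → Brick G
brick′⇒brick G (conn , bic) = connectedMinus₂⇒threeConnected G (proj₁ bic) conn , bic

NoDiamond : Graph → Set
NoDiamond G = ∀ (T : Triangle G) d u v → ¬ InT T d → InT T u → InT T v → u ≢ v →
  Adjacent G d u → Adjacent G d v → ⊥

-- K4 has diamonds; this weaker form is all that a Y→Δ-operation on x needs.
NoDiamondAvoiding : (G : Graph) → Fin (size G) → Set
NoDiamondAvoiding G x = ∀ (T : Triangle G) d u v →
  Triangle.a T ≢ x → Triangle.b T ≢ x → Triangle.c T ≢ x → d ≢ x →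
  ¬ InT T d → InT T u → InT T v → u ≢ v → Adjacent G d u → Adjacent G d v → ⊥

module ≅-Transport {G H : Graph} (σ : G ≅ H) where
  to : Fin (size G) → Fin (size H)
  to = Inverse.to (proj₁ σ)

  from : Fin (size H) → Fin (size G)
  from = Inverse.from (proj₁ σ)

  to-from : ∀ x → to (from x) ≡ x
  to-from x = Perm.inverseʳ (proj₁ σ)

  from-to : ∀ x → from (to x) ≡ x
  from-to x = Perm.inverseˡ (proj₁ σ)

  to-injective : ∀ {x y} → to x ≡ to y → x ≡ y
  to-injective {x} {y} e = trans (sym (from-to x)) (trans (cong from e) (from-to y))

  to-mult : ∀ u v → mult H (to u) (to v) ≡ mult G u v
  to-mult = proj₂ σ

  from-mult : ∀ u v → mult G (from u) (from v) ≡ mult H u v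
  from-mult u v = trans (sym (to-mult (from u) (from v))) (cong₂ (mult H) (to-from u) (to-from v))

  from-≢ : ∀ {x u} → x ≢ to u → from x ≢ u
  from-≢ {x} x≢ e = x≢ (trans (sym (to-from x)) (cong to e))

  cubic : Cubic H → Cubic G
  cubic cubicH v = begin
    Σfin (size G) (mult G v)            ≡⟨ Σfin-cong (size G) (λ u → sym (to-mult v u)) ⟩
    Σfin (size G) (mult H (to v) ∘ to)  ≡⟨ Σfin-permute (size G) (size H) (proj₁ σ) (mult H (to v)) ⟩
    degree H (to v)                     ≡⟨ cubicH (to v) ⟩
    3                                   ∎
    where open ≡-Reasoning

  walk : ∀ {a b u v} → WalkMinus₂ H (to a) (to b) u v → WalkMinus₂ G a b (from u) (from v)
  walk here = here
  walk (step {u} {w} adj w≢a w≢b p) =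
    step (subst (1 ≤_) (sym (from-mult u w)) adj) (from-≢ w≢a) (from-≢ w≢b) (walk p)

  connectedMinus₂ : ConnectedMinus₂ H → ConnectedMinus₂ G
  connectedMinus₂ conn a b u v u≢a u≢b v≢a v≢b = subst₂ (WalkMinus₂ G a b) (from-to u) (from-to v)
    (walk (conn (to a) (to b) (to u) (to v)
      (u≢a ∘ to-injective) (u≢b ∘ to-injective) (v≢a ∘ to-injective) (v≢b ∘ to-injective)))

  matching : ∀ {s t} → PMMinus2 H (to s) (to t) → PMMinus2 G s t
  matching (p , ok) = from ∘ p ∘ to , λ w w≢s w≢t →
    let (ps≢ , pt≢ , pw≢ , pp≡ , adj) = ok (to w) (w≢s ∘ to-injective) (w≢t ∘ to-injective) in
    from-≢ ps≢ , from-≢ pt≢ , from-≢ pw≢ ,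
    trans (cong (from ∘ p) (to-from _)) (trans (cong from pp≡) (from-to w)) ,
    subst (1 ≤_) (trans (cong (mult H (to w)) (sym (to-from _))) (to-mult w _)) adj

  bicritical : Bicritical H → Bicritical G
  bicritical (4≤ , pm) = subst (4 ≤_) (sym (Perm.↔⇒≡ (proj₁ σ))) 4≤ ,
    λ s t s≢t → matching (pm (to s) (to t) (s≢t ∘ to-injective))

  brick′ : Brick′ H → Brick′ G
  brick′ (conn , bic) = connectedMinus₂ conn , bicritical bic

  triangle′ : Triangle G → Triangle H
  triangle′ (triangle a b c a≢b b≢c a≢c ab bc ac) =
    triangle (to a) (to b) (to c) (a≢b ∘ to-injective) (b≢c ∘ to-injective) (a≢c ∘ to-injective)
      (subst (1 ≤_) (sym (to-mult a b)) ab) (subst (1 ≤_) (sym (to-mult b c)) bc) (subst (1 ≤_) (sym (to-mult a c)) ac)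

  inT⁺ : ∀ T {u} → InT T u → InT (triangle′ T) (to u)
  inT⁺ T = Sum.map (cong to) (Sum.map (cong to) (cong to))

  inT⁻ : ∀ T {u} → InT (triangle′ T) (to u) → InT T u
  inT⁻ T = Sum.map to-injective (Sum.map to-injective to-injective)

  contraction : ∀ {T K} → Contraction H (triangle′ T) K → Contraction G T K
  contraction {T} {K} C = record
    { f       = C.f ∘ to
    ; onto    = λ q → from (proj₁ (C.onto q)) , λ e → proj₂ (C.onto q) (trans (cong to e) (to-from _))
    ; fibres  = λ u v → fibres⁻ u v ∘ proj₁ (C.fibres (to u) (to v)) , proj₂ (C.fibres (to u) (to v)) ∘ fibres⁺ u v
    ; edges   = λ p q p≢q → trans (C.edges p q p≢q) (sym (reindex p q))
    ; noLoops = C.noLoops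
    }
    where
    module C = Contraction C
    T′ = triangle′ T
    fibres⁻ : ∀ u v → to u ≡ to v ⊎ (InT T′ (to u) × InT T′ (to v)) → u ≡ v ⊎ (InT T u × InT T v)
    fibres⁻ u v = Sum.map to-injective (Product.map (inT⁻ T) (inT⁻ T))
    fibres⁺ : ∀ u v → u ≡ v ⊎ (InT T u × InT T v) → to u ≡ to v ⊎ (InT T′ (to u) × InT T′ (to v))
    fibres⁺ u v = Sum.map (cong to) (Product.map (inT⁺ T) (inT⁺ T))
    reindex : ∀ p q →
      Σfin (size G) (λ u → Σfin (size G) (λ v → ind (C.f (to u) ≟ p) * ind (C.f (to v) ≟ q) * mult G u v)) ≡
      Σfin (size H) (λ u → Σfin (size H) (λ v → ind (C.f u ≟ p) * ind (C.f v ≟ q) * mult H u v))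
    reindex p q = trans
      (Σfin-cong (size G) (λ u → trans
        (Σfin-cong (size G) (λ v → cong (ind (C.f (to u) ≟ p) * ind (C.f (to v) ≟ q) *_) (sym (to-mult u v))))
        (Σfin-permute (size G) (size H) (proj₁ σ) (λ v → ind (C.f (to u) ≟ p) * ind (C.f v ≟ q) * mult H (to u) v))))
      (Σfin-permute (size G) (size H) (proj₁ σ) (λ u → Σfin (size H) (λ v → ind (C.f u ≟ p) * ind (C.f v ≟ q) * mult H u v)))

-- The two quotient maps have the same fibres, so each factors through the other.
contraction-unique : ∀ {G T H K} → Contraction G T H → Contraction G T K → H ≅ K
contraction-unique {G} {T} {H} {K} C₁ C₂ = mk↔ₛ′ τ τ⁻¹ τ-τ⁻¹ τ⁻¹-τ , τ-mult
  where
  module C₁ = Contraction C₁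
  module C₂ = Contraction C₂
  sec₁ : Fin (size H) → Fin (size G)
  sec₁ p = proj₁ (C₁.onto p)
  sec₂ : Fin (size K) → Fin (size G)
  sec₂ q = proj₁ (C₂.onto q)
  f₁-sec₁ : ∀ p → C₁.f (sec₁ p) ≡ p
  f₁-sec₁ p = proj₂ (C₁.onto p) refl
  f₂-sec₂ : ∀ q → C₂.f (sec₂ q) ≡ q
  f₂-sec₂ q = proj₂ (C₂.onto q) refl
  f₁⇒f₂ : ∀ u v → C₁.f u ≡ C₁.f v → C₂.f u ≡ C₂.f v
  f₁⇒f₂ u v = proj₂ (C₂.fibres u v) ∘ proj₁ (C₁.fibres u v)
  f₂⇒f₁ : ∀ u v → C₂.f u ≡ C₂.f v → C₁.f u ≡ C₁.f v
  f₂⇒f₁ u v = proj₂ (C₁.fibres u v) ∘ proj₁ (C₂.fibres u v)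
  τ : Fin (size H) → Fin (size K)
  τ p = C₂.f (sec₁ p)
  τ⁻¹ : Fin (size K) → Fin (size H)
  τ⁻¹ q = C₁.f (sec₂ q)
  τ-τ⁻¹ : ∀ q → τ (τ⁻¹ q) ≡ q
  τ-τ⁻¹ q = trans (f₁⇒f₂ (sec₁ (τ⁻¹ q)) (sec₂ q) (f₁-sec₁ (τ⁻¹ q))) (f₂-sec₂ q)
  τ⁻¹-τ : ∀ p → τ⁻¹ (τ p) ≡ p
  τ⁻¹-τ p = trans (f₂⇒f₁ (sec₂ (τ p)) (sec₁ p) (f₂-sec₂ (τ p))) (f₁-sec₁ p)
  ind-τ : ∀ u p → ind (C₂.f u ≟ τ p) ≡ ind (C₁.f u ≟ p)
  ind-τ u p = ind-cong _ _ (λ e → trans (f₂⇒f₁ u (sec₁ p) e) (f₁-sec₁ p))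
                           (λ e → f₁⇒f₂ u (sec₁ p) (trans e (sym (f₁-sec₁ p))))
  τ-mult : ∀ p q → mult K (τ p) (τ q) ≡ mult H p q
  τ-mult p q with p ≟ q
  ... | yes refl = trans (C₂.noLoops (τ p)) (sym (C₁.noLoops p))
  ... | no p≢q = trans (C₂.edges (τ p) (τ q) (λ e → p≢q (trans (sym (τ⁻¹-τ p)) (trans (cong τ⁻¹ e) (τ⁻¹-τ q)))))
      (trans (Σfin-cong (size G) (λ u → Σfin-cong (size G) (λ v →
         cong₂ (λ i j → i * j * mult G u v) (ind-τ u p) (ind-τ v q))))
       (sym (C₁.edges p q p≢q)))

contraction-isGraph : ∀ {G T K} → IsGraph G → Contraction G T K → IsGraph K
contraction-isGraph {G} {T} {K} isG C = record { symmetric = symmetric ; loopless = C.noLoops }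
  where
  module C = Contraction C
  n = size G
  symmetric : ∀ p q → mult K p q ≡ mult K q p
  symmetric p q with p ≟ q
  ... | yes refl = refl
  ... | no p≢q = trans (C.edges p q p≢q) (trans (Σfin-comm n n _)
     (trans (Σfin-cong n (λ u → Σfin-cong n (λ v → summand u v))) (sym (C.edges q p (p≢q ∘ sym)))))
    where
    summand : ∀ u v → ind (C.f v ≟ p) * ind (C.f u ≟ q) * mult G v u ≡ ind (C.f u ≟ q) * ind (C.f v ≟ p) * mult G u v
    summand u v = cong₂ _*_ (*-comm (ind (C.f v ≟ p)) _) (IsGraph.symmetric isG v u)

-- the corner other than i and j (junk when i ≡ j)
third : Fin 3 → Fin 3 → Fin 3
third zero       (suc zero) = suc (suc zero)
third (suc zero) zero       = suc (suc zero)
third zero       (suc (suc zero)) = suc zero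
third (suc (suc zero)) zero = suc zero
third _ _ = zero

third-≢ˡ : ∀ i j → i ≢ j → third i j ≢ i
third-≢ˡ = toWitness {a? = all? λ i → all? λ j → ¬? (i ≟ j) →-dec ¬? (third i j ≟ i)} tt

third-≢ʳ : ∀ i j → i ≢ j → third i j ≢ j
third-≢ʳ = toWitness {a? = all? λ i → all? λ j → ¬? (i ≟ j) →-dec ¬? (third i j ≟ j)} tt

third-unique : ∀ i j l → i ≢ j → l ≢ i → l ≢ j → l ≡ third i j
third-unique = toWitness {a? = all? λ i → all? λ j → all? λ l →
  ¬? (i ≟ j) →-dec ¬? (l ≟ i) →-dec ¬? (l ≟ j) →-dec l ≟ third i j} tt

third-involutive : ∀ i j → i ≢ j → third i (third i j) ≡ j
third-involutive i j i≢j =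
  sym (third-unique i (third i j) j (third-≢ˡ i j i≢j ∘ sym) (i≢j ∘ sym) (third-≢ʳ i j i≢j ∘ sym))

Fin3-cover : ∀ {i j k} → i ≢ j → j ≢ k → i ≢ k → ∀ l → l ≡ i ⊎ l ≡ j ⊎ l ≡ k
Fin3-cover {i} {j} {k} i≢j j≢k i≢k l with l ≟ i | l ≟ j
... | yes l≡i | _       = inj₁ l≡i
... | no _    | yes l≡j = inj₂ (inj₁ l≡j)
... | no l≢i  | no l≢j  = inj₂ (inj₂ (trans (third-unique i j l i≢j l≢i l≢j) (sym (third-unique i j k i≢j (i≢k ∘ sym) (j≢k ∘ sym)))))

module _ {n} (y : Fin 3 → Fin n) where

  private
    i₀ i₁ i₂ : Fin n → ℕ
    i₀ v = ind (y zero ≟ v)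
    i₁ v = ind (y (suc zero) ≟ v)
    i₂ v = ind (y (suc (suc zero)) ≟ v)

  countY-positive : ∀ v → 1 ≤ countY y v → ∃[ i ] y i ≡ v
  countY-positive v 1≤c with y zero ≟ v | y (suc zero) ≟ v | y (suc (suc zero)) ≟ v
  ... | yes e | _     | _     = zero , e
  ... | no _  | yes e | _     = suc zero , e
  ... | no _  | no _  | yes e = suc (suc zero) , e

  ind≤countY : ∀ i v → ind (y i ≟ v) ≤ countY y v
  ind≤countY zero             v = ≤-trans (m≤m+n (i₀ v) (i₁ v)) (m≤m+n _ (i₂ v))
  ind≤countY (suc zero)       v = ≤-trans (m≤n+m (i₁ v) (i₀ v)) (m≤m+n _ (i₂ v))
  ind≤countY (suc (suc zero)) v = m≤n+m (i₂ v) _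

  y∈countY : ∀ i → 1 ≤ countY y (y i)
  y∈countY i = ≤-trans (≤-reflexive (sym (ind-yes (y i ≟ y i) refl))) (ind≤countY i (y i))

  ind+ind≤countY : ∀ i j v → i ≢ j → ind (y i ≟ v) + ind (y j ≟ v) ≤ countY y v
  ind+ind≤countY zero             zero             v i≢j = contradiction refl i≢j
  ind+ind≤countY (suc zero)       (suc zero)       v i≢j = contradiction refl i≢j
  ind+ind≤countY (suc (suc zero)) (suc (suc zero)) v i≢j = contradiction refl i≢j
  ind+ind≤countY zero             (suc zero)       v _ = m≤m+n (i₀ v + i₁ v) (i₂ v)
  ind+ind≤countY zero             (suc (suc zero)) v _ = +-monoˡ-≤ (i₂ v) (m≤m+n (i₀ v) (i₁ v))
  ind+ind≤countY (suc zero)       (suc (suc zero)) v _ = +-monoˡ-≤ (i₂ v) (m≤n+m (i₁ v) (i₀ v))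
  ind+ind≤countY (suc zero)       zero             v _ =
    subst (_≤ countY y v) (+-comm (i₀ v) (i₁ v)) (ind+ind≤countY zero (suc zero) v λ ())
  ind+ind≤countY (suc (suc zero)) zero             v _ =
    subst (_≤ countY y v) (+-comm (i₀ v) (i₂ v)) (ind+ind≤countY zero (suc (suc zero)) v λ ())
  ind+ind≤countY (suc (suc zero)) (suc zero)       v _ =
    subst (_≤ countY y v) (+-comm (i₁ v) (i₂ v)) (ind+ind≤countY (suc zero) (suc (suc zero)) v λ ())

  countY≤1⇒injective : (∀ v → countY y v ≤ 1) → ∀ i j → y i ≡ y j → i ≡ j
  countY≤1⇒injective c≤1 i j yi≡yj with i ≟ j
  ... | yes i≡j = i≡j
  ... | no  i≢j = contradiction (≤-trans 2≤ (c≤1 (y j))) λ { (s≤s ()) }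
    where
    2≤ : 2 ≤ countY y (y j)
    2≤ = subst (_≤ countY y (y j)) (cong₂ _+_ (ind-yes (y i ≟ y j) yi≡yj) (ind-yes (y j ≟ y j) refl))
           (ind+ind≤countY i j (y j) i≢j)

old-injective : ∀ {m} {a b : Fin m} → old a ≡ old b → a ≡ b
old-injective refl = refl

tri-injective : ∀ {m} {i j : Fin 3} → tri {m} i ≡ tri j → i ≡ j
tri-injective refl = refl

_≟R_ : ∀ {m} (r s : Role m) → Dec (r ≡ s)
old a ≟R old b = map′ (cong old) old-injective (a ≟ b)
old a ≟R tri j = no λ ()
tri i ≟R old b = no λ ()
tri i ≟R tri j = map′ (cong tri) tri-injective (i ≟ j)

module YΔ-Roles (G : Graph) (x : Fin (size G)) (y : Fin 3 → Fin (size G)) where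
  n : ℕ
  n = size G

  M : Role n → Role n → ℕ
  M = roleMult G y

  -- old x is not a vertex of YΔ G x y: the corner tri zero takes its place.
  Valid : Role n → Set
  Valid (old a) = a ≢ x
  Valid (tri _) = ⊤

  collapse : Role n → Fin n
  collapse (old a) = a
  collapse (tri _) = x

  embed : Role n → Fin (n + 2)
  embed (old a)       = a ↑ˡ 2
  embed (tri zero)    = x ↑ˡ 2
  embed (tri (suc j)) = n ↑ʳ j

  oldRole : (a : Fin n) → Dec (a ≡ x) → Role n
  oldRole a (yes _) = tri zero
  oldRole a (no _)  = old a

  splitRole : Fin n ⊎ Fin 2 → Role n
  splitRole (inj₁ a) = oldRole a (a ≟ x)
  splitRole (inj₂ j) = tri (suc j)

  role-splitAt : ∀ v → role x v ≡ splitRole (splitAt n v)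
  role-splitAt v with splitAt n v
  ... | inj₂ j = refl
  ... | inj₁ a with a ≟ x
  ...   | yes _ = refl
  ...   | no _  = refl

  tri-tri : ∀ {i j} → i ≢ j → 1 ≤ M (tri i) (tri j)
  tri-tri {i} {j} i≢j = ≤-reflexive (sym (nind-no (i ≟ j) i≢j))

  old-tri : ∀ {i a} → y i ≡ a → 1 ≤ M (old a) (tri i)
  old-tri {i} {a} e = ≤-reflexive (sym (ind-yes (y i ≟ a) e))

  tri-old : ∀ {i a} → y i ≡ a → 1 ≤ M (tri i) (old a)
  tri-old {i} {a} e = ≤-reflexive (sym (ind-yes (y i ≟ a) e))

  old-tri⁻ : ∀ {i a} → 1 ≤ M (old a) (tri i) → y i ≡ a
  old-tri⁻ {i} {a} = ind-positive (y i ≟ a)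

  tri-old⁻ : ∀ {i a} → 1 ≤ M (tri i) (old a) → y i ≡ a
  tri-old⁻ {i} {a} = ind-positive (y i ≟ a)

  role↑ˡ : Fin n → Role n
  role↑ˡ a = role x (a ↑ˡ 2)

  role↑ˡ≡oldRole : ∀ a → role↑ˡ a ≡ oldRole a (a ≟ x)
  role↑ˡ≡oldRole a = trans (role-splitAt (a ↑ˡ 2)) (cong splitRole (splitAt-↑ˡ n a 2))

  role↑ˡ-old : ∀ {a} → a ≢ x → role↑ˡ a ≡ old a
  role↑ˡ-old {a} a≢x = trans (role↑ˡ≡oldRole a) (lemma (a ≟ x))
    where
    lemma : (a? : Dec (a ≡ x)) → oldRole a a? ≡ old a
    lemma (yes a≡x) = contradiction a≡x a≢x
    lemma (no _)    = refl

  role↑ˡ-x : role↑ˡ x ≡ tri zero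
  role↑ˡ-x = trans (role↑ˡ≡oldRole x) (lemma (x ≟ x))
    where
    lemma : (x? : Dec (x ≡ x)) → oldRole x x? ≡ tri zero
    lemma (yes _)  = refl
    lemma (no x≢x) = contradiction refl x≢x

  role-↑ʳ : ∀ j → role x (n ↑ʳ j) ≡ tri (suc j)
  role-↑ʳ j = trans (role-splitAt (n ↑ʳ j)) (cong splitRole (splitAt-↑ʳ n 2 j))

  role↑ˡ-elim : ∀ (P : Fin n → Role n → Set) → P x (tri zero) → (∀ a → a ≢ x → P a (old a)) →
    ∀ a → P a (role↑ˡ a)
  role↑ˡ-elim P Px Pold a with a ≟ x
  ... | yes refl = subst (P x) (sym role↑ˡ-x) Px
  ... | no a≢x   = subst (P a) (sym (role↑ˡ-old a≢x)) (Pold a a≢x)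

  role-embed : ∀ r → Valid r → role x (embed r) ≡ r
  role-embed (old a)       a≢x = role↑ˡ-old a≢x
  role-embed (tri zero)    _   = role↑ˡ-x
  role-embed (tri (suc j)) _   = role-↑ʳ j

  embed-role : ∀ v → embed (role x v) ≡ v
  embed-role v = trans (cong embed (role-splitAt v)) (lemma (splitAt n v) (join-splitAt n 2 v))
    where
    lemma : ∀ s → join n 2 s ≡ v → embed (splitRole s) ≡ v
    lemma (inj₂ j) e = e
    lemma (inj₁ a) e with a ≟ x
    ... | yes refl = e
    ... | no _     = e

  role-valid : ∀ v → Valid (role x v)
  role-valid v = subst Valid (sym (role-splitAt v)) (lemma (splitAt n v))
    where
    lemma : ∀ s → Valid (splitRole s)
    lemma (inj₂ j) = tt
    lemma (inj₁ a) with a ≟ x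
    ... | yes _  = tt
    ... | no a≢x = a≢x

  role-injective : ∀ {u v} → role x u ≡ role x v → u ≡ v
  role-injective {u} {v} e = trans (sym (embed-role u)) (trans (cong embed e) (embed-role v))

  embed-injective : ∀ {r s} → Valid r → Valid s → embed r ≡ embed s → r ≡ s
  embed-injective {r} {s} vr vs e = trans (sym (role-embed r vr)) (trans (cong (role x) e) (role-embed s vs))

  Σfin-role : ∀ (F : Role n → ℕ) →
    Σfin (n + 2) (F ∘ role x) ≡ Σfin n (F ∘ role↑ˡ) + (F (tri (suc zero)) + (F (tri (suc (suc zero))) + 0))
  Σfin-role F = trans (Σfin-↑ n 2 (F ∘ role x))
    (cong (Σfin n (F ∘ role↑ˡ) +_) (cong₂ (λ p q → p + (q + 0)) (cong F (role-↑ʳ zero)) (cong F (role-↑ʳ (suc zero)))))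

  -- Among the old vertices, role↑ˡ only swaps old x for tri zero.
  Σfin-role↑ˡ : ∀ (F : Role n → ℕ) →
    Σfin n (F ∘ role↑ˡ) + F (old x) ≡ Σfin n (F ∘ old) + F (tri zero)
  Σfin-role↑ˡ F = begin
    Σfin n (F ∘ role↑ˡ) + F (old x)
      ≡⟨ cong (Σfin n (F ∘ role↑ˡ) +_) (sym (Σfin-ind n x (λ _ → F (old x)))) ⟩
    Σfin n (F ∘ role↑ˡ) + Σfin n (λ a → ind (a ≟ x) * F (old x))
      ≡⟨ sym (Σfin-distrib-+ n _ _) ⟩
    Σfin n (λ a → F (role↑ˡ a) + ind (a ≟ x) * F (old x))
      ≡⟨ Σfin-cong n (role↑ˡ-elim (λ a r → F r + ind (a ≟ x) * F (old x) ≡ F (old a) + ind (a ≟ x) * F (tri zero))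
           swap (λ a a≢x → cong (F (old a) +_) (trans (cong (_* _) (ind-no (a ≟ x) a≢x)) (sym (cong (_* _) (ind-no (a ≟ x) a≢x)))))) ⟩
    Σfin n (λ a → F (old a) + ind (a ≟ x) * F (tri zero))
      ≡⟨ Σfin-distrib-+ n _ _ ⟩
    Σfin n (F ∘ old) + Σfin n (λ a → ind (a ≟ x) * F (tri zero))
      ≡⟨ cong (Σfin n (F ∘ old) +_) (Σfin-ind n x (λ _ → F (tri zero))) ⟩
    Σfin n (F ∘ old) + F (tri zero) ∎
    where
    open ≡-Reasoning
    swap : F (tri zero) + ind (x ≟ x) * F (old x) ≡ F (old x) + ind (x ≟ x) * F (tri zero)
    swap rewrite ind-yes (x ≟ x) refl = solve 2 (λ t o → t :+ con 1 :* o := o :+ con 1 :* t) refl (F (tri zero)) (F (old x))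

  simple : Simple G → Simple (YΔ G x y)
  simple simpleG u v = lemma (role x u) (role x v)
    where
    lemma : ∀ r s → M r s ≤ 1
    lemma (old a) (old b) = simpleG a b
    lemma (old a) (tri i) = ind≤1 _
    lemma (tri i) (old b) = ind≤1 _
    lemma (tri i) (tri j) = nind≤1 _

  module Properties (isG : IsGraph G) (nbrs : Nbrs G x y) where
    y≢x : ∀ i → y i ≢ x
    y≢x i refl = contradiction (≤-trans (y∈countY y i) (≤-reflexive (trans (sym (nbrs x)) (IsGraph.loopless isG x)))) λ ()

    neighbour : ∀ w → Adjacent G x w → ∃[ i ] y i ≡ w
    neighbour w adj = countY-positive y w (subst (1 ≤_) (nbrs w) adj)

    adjacent-y : ∀ i → Adjacent G x (y i)
    adjacent-y i = subst (1 ≤_) (sym (nbrs (y i))) (y∈countY y i)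

    M-sym : ∀ r s → M r s ≡ M s r
    M-sym (old a) (old b) = IsGraph.symmetric isG a b
    M-sym (old a) (tri i) = refl
    M-sym (tri i) (old b) = refl
    M-sym (tri i) (tri j) = nind-cong (i ≟ j) (j ≟ i) sym sym

    isGraph : IsGraph (YΔ G x y)
    isGraph = record { symmetric = λ u v → M-sym (role x u) (role x v) ; loopless = loopless ∘ role x }
      where
      loopless : ∀ r → M r r ≡ 0
      loopless (old a) = IsGraph.loopless isG a
      loopless (tri i) = nind-yes (i ≟ i) refl

    degree-role : Cubic G → ∀ r → Valid r →
      Σfin n (M r ∘ role↑ˡ) + (M r (tri (suc zero)) + (M r (tri (suc (suc zero))) + 0)) ≡ 3
    degree-role cubicG (old c) _ = +-cancelʳ-≡ i₀ _ _ (begin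
      S + (i₁ + (i₂ + 0)) + i₀   ≡⟨ solve 4 (λ s a b c → s :+ (b :+ (c :+ con 0)) :+ a := s :+ (a :+ b :+ c)) refl S i₀ i₁ i₂ ⟩
      S + countY y c             ≡⟨ cong (S +_) (trans (sym (nbrs c)) (IsGraph.symmetric isG x c)) ⟩
      S + mult G c x             ≡⟨ Σfin-role↑ˡ (M (old c)) ⟩
      degree G c + i₀            ≡⟨ cong (_+ i₀) (cubicG c) ⟩
      3 + i₀                     ∎)
      where
      open ≡-Reasoning
      S  = Σfin n (M (old c) ∘ role↑ˡ)
      i₀ = ind (y zero ≟ c)
      i₁ = ind (y (suc zero) ≟ c)
      i₂ = ind (y (suc (suc zero)) ≟ c)
    degree-role cubicG (tri i) _ = begin
      S + (M (tri i) (tri (suc zero)) + (M (tri i) (tri (suc (suc zero))) + 0))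
        ≡⟨ cong (_+ (nind (i ≟ suc zero) + (nind (i ≟ suc (suc zero)) + 0))) S≡ ⟩
      1 + nind (i ≟ zero) + (nind (i ≟ suc zero) + (nind (i ≟ suc (suc zero)) + 0))
        ≡⟨ count i ⟩
      3 ∎
      where
      open ≡-Reasoning
      S = Σfin n (M (tri i) ∘ role↑ˡ)
      S≡ : S ≡ 1 + nind (i ≟ zero)
      S≡ = begin
        S                                               ≡⟨ sym (+-identityʳ S) ⟩
        S + 0                                           ≡⟨ cong (S +_) (sym (ind-no (y i ≟ x) (y≢x i))) ⟩
        S + M (tri i) (old x)                           ≡⟨ Σfin-role↑ˡ (M (tri i)) ⟩
        Σfin n (λ a → ind (y i ≟ a)) + nind (i ≟ zero)  ≡⟨ cong (_+ nind (i ≟ zero)) (Σfin-ind-sym n (y i)) ⟩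
        1 + nind (i ≟ zero)                             ∎
      count : ∀ i → 1 + nind (i ≟ zero) + (nind (i ≟ suc zero) + (nind (i ≟ suc (suc zero)) + 0)) ≡ 3
      count zero             = refl
      count (suc zero)       = refl
      count (suc (suc zero)) = refl

    cubic : Cubic G → Cubic (YΔ G x y)
    cubic cubicG u = trans (Σfin-role (M (role x u))) (degree-role cubicG (role x u) (role-valid u))

module YΔ-Connectivity (G : Graph) (x : Fin (size G)) (y : Fin 3 → Fin (size G))
    (isG : IsGraph G) (nbrs : Nbrs G x y) (y-injective : ∀ i j → y i ≡ y j → i ≡ j)
    (connG : ConnectedMinus₂ G) where
  open YΔ-Roles G x y
  open Properties isG nbrs

  data RoleWalk (A B : Role n) : Role n → Role n → Set where
    here : ∀ {R} → RoleWalk A B R R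
    step : ∀ {R S Q} → 1 ≤ M R S → Valid S → S ≢ A → S ≢ B → RoleWalk A B S Q → RoleWalk A B R Q

  _++_ : ∀ {A B R S Q} → RoleWalk A B R S → RoleWalk A B S Q → RoleWalk A B R Q
  here              ++ q = q
  step adj v a b p ++ q = step adj v a b (p ++ q)

  swap : ∀ {A B R S} → RoleWalk A B R S → RoleWalk B A R S
  swap here               = here
  swap (step adj v a b p) = step adj v b a (swap p)

  toWalk : ∀ {a b R Q} → Valid R → RoleWalk (role x a) (role x b) R Q → WalkMinus₂ (YΔ G x y) a b (embed R) (embed Q)
  toWalk vR here = here
  toWalk {R = R} vR (step {S = S} adj vS S≢A S≢B p) =
    step (subst (1 ≤_) (sym (cong₂ M (role-embed R vR) (role-embed S vS))) adj)
      (λ e → S≢A (trans (sym (role-embed S vS)) (cong (role x) e)))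
      (λ e → S≢B (trans (sym (role-embed S vS)) (cong (role x) e))) (toWalk vS p)

  module AvoidingOld (a₀ b₀ : Fin n) (a₀≢x : a₀ ≢ x) (b₀≢x : b₀ ≢ x) where
    A B : Role n
    A = old a₀
    B = old b₀

    -- A walk of G - a₀ - b₀ through x enters and leaves the new triangle at the corners facing its neighbours.
    lift : ∀ {w v} → WalkMinus₂ G a₀ b₀ w v → ∀ R → Valid R → collapse R ≡ w →
      ∃[ S ] Valid S × collapse S ≡ v × RoleWalk A B R S
    lift here R vR e = R , vR , e , here
    lift (step {w = w′} adj w′≢a w′≢b p) R vR e with w′ ≟ x
    lift (step {w = w′} adj w′≢a w′≢b p) (old c) vR refl | no w′≢x =
      let (S , vS , eS , q) = lift p (old w′) w′≢x refl in
      S , vS , eS , step adj w′≢x (w′≢a ∘ cong collapse) (w′≢b ∘ cong collapse) q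
    lift (step {w = w′} adj w′≢a w′≢b p) (tri j) vR refl | no w′≢x with neighbour w′ adj
    ... | i , yi≡w′ with i ≟ j
    ...   | yes refl = let (S , vS , eS , q) = lift p (old w′) w′≢x refl in
      S , vS , eS , step (tri-old yi≡w′) w′≢x (w′≢a ∘ cong collapse) (w′≢b ∘ cong collapse) q
    ...   | no i≢j = let (S , vS , eS , q) = lift p (old w′) w′≢x refl in
      S , vS , eS , step (tri-tri (i≢j ∘ sym)) tt (λ ()) (λ ())
        (step (tri-old yi≡w′) w′≢x (w′≢a ∘ cong collapse) (w′≢b ∘ cong collapse) q)
    lift (step adj _ _ p) (tri j) vR refl | yes refl =
      contradiction (≤-trans adj (≤-reflexive (IsGraph.loopless isG x))) λ ()
    lift (step adj _ _ p) (old c) vR refl | yes refl with neighbour c (subst (1 ≤_) (IsGraph.symmetric isG c x) adj)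
    ... | i , yi≡c = let (S , vS , eS , q) = lift p (tri i) tt refl in
      S , vS , eS , step (old-tri yi≡c) tt (λ ()) (λ ()) q

    close : ∀ S V → Valid S → Valid V → collapse S ≡ collapse V → V ≢ A → V ≢ B → RoleWalk A B S V
    close (old s) (old v) _ _ refl _ _ = here
    close (old s) (tri j) s≢x _ e _ _ = contradiction e s≢x
    close (tri i) (old v) _ v≢x e _ _ = contradiction (sym e) v≢x
    close (tri i) (tri j) _ _ _ V≢A V≢B with i ≟ j
    ... | yes refl = here
    ... | no i≢j = step (tri-tri i≢j) tt V≢A V≢B here

    collapse-≢ : ∀ {c} → c ≢ x → ∀ R → R ≢ old c → collapse R ≢ c
    collapse-≢ c≢x (old r) R≢c e = R≢c (cong old e)
    collapse-≢ c≢x (tri _) _   e = c≢x (sym e)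

    connected : ∀ U V → Valid U → Valid V → U ≢ A → U ≢ B → V ≢ A → V ≢ B → RoleWalk A B U V
    connected U V vU vV U≢A U≢B V≢A V≢B =
      let (S , vS , eS , q) = lift (connG a₀ b₀ (collapse U) (collapse V)
            (collapse-≢ a₀≢x U U≢A) (collapse-≢ b₀≢x U U≢B) (collapse-≢ a₀≢x V V≢A) (collapse-≢ b₀≢x V V≢B)) U vU refl in
      q ++ close S V vS vV eS V≢A V≢B

  module AvoidingTri (i : Fin 3) (B : Role n) (vB : Valid B) where
    A : Role n
    A = tri i

    b₀ : Fin n
    b₀ = collapse B

    old≢B : ∀ {z} → z ≢ b₀ → old z ≢ B
    old≢B z≢b e = z≢b (cong collapse e)

    old-walk : ∀ {w v} → WalkMinus₂ G x b₀ w v → RoleWalk A B (old w) (old v)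
    old-walk here = here
    old-walk (step adj w≢x w≢b p) = step adj w≢x (λ ()) (old≢B w≢b) (old-walk p)

    -- If the corner j faces b₀, go round the triangle through the third corner, which is neither i nor j.
    exit : ∀ j → tri j ≢ A → tri j ≢ B → ∃[ w ] w ≢ x × w ≢ b₀ × RoleWalk A B (old w) (tri j)
    exit j j≢A j≢B with y j ≟ b₀
    ... | no yj≢b = y j , y≢x j , yj≢b , step (old-tri refl) tt j≢A j≢B here
    ... | yes yj≡b = y k , y≢x k , (λ e → k≢j (y-injective k j (trans e (sym yj≡b)))) ,
           step (old-tri refl) tt (third-≢ˡ i j i≢j ∘ tri-injective) (λ e → y≢x j (trans yj≡b (cong collapse (sym e))))
             (step (tri-tri k≢j) tt j≢A j≢B here)
      where
      i≢j : i ≢ j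
      i≢j e = j≢A (cong tri (sym e))
      k = third i j
      k≢j = third-≢ʳ i j i≢j

    enter : ∀ j → tri j ≢ A → tri j ≢ B → ∃[ w ] w ≢ x × w ≢ b₀ × RoleWalk A B (tri j) (old w)
    enter j j≢A j≢B with y j ≟ b₀
    ... | no yj≢b = y j , y≢x j , yj≢b , step (tri-old refl) (y≢x j) (λ ()) (old≢B yj≢b) here
    ... | yes yj≡b = y k , y≢x k , yk≢b ,
           step (tri-tri (k≢j ∘ sym)) tt (third-≢ˡ i j i≢j ∘ tri-injective) (λ e → y≢x j (trans yj≡b (cong collapse (sym e))))
             (step (tri-old refl) (y≢x k) (λ ()) (old≢B yk≢b) here)
      where
      i≢j : i ≢ j
      i≢j e = j≢A (cong tri (sym e))
      k = third i j
      k≢j = third-≢ʳ i j i≢j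
      yk≢b : y k ≢ b₀
      yk≢b e = k≢j (y-injective k j (trans e (sym yj≡b)))

    old≢b₀ : ∀ {u} → u ≢ x → old u ≢ B → u ≢ b₀
    old≢b₀ u≢x u≢B = lemma B u≢B
      where
      lemma : ∀ B′ → old _ ≢ B′ → _ ≢ collapse B′
      lemma (old b) u≢B e = u≢B (cong old e)
      lemma (tri _) _   e = u≢x e

    connected : ∀ U V → Valid U → Valid V → U ≢ A → U ≢ B → V ≢ A → V ≢ B → RoleWalk A B U V
    connected (tri j) (tri k) _ _ _ _ V≢A V≢B with j ≟ k
    ... | yes refl = here
    ... | no j≢k = step (tri-tri j≢k) tt V≢A V≢B here
    connected (old u) (old v) u≢x v≢x _ U≢B _ V≢B =
      old-walk (connG x b₀ u v u≢x (old≢b₀ u≢x U≢B) v≢x (old≢b₀ v≢x V≢B))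
    connected (old u) (tri j) u≢x _ _ U≢B V≢A V≢B =
      let (w , w≢x , w≢b , q) = exit j V≢A V≢B in
      old-walk (connG x b₀ u w u≢x (old≢b₀ u≢x U≢B) w≢x w≢b) ++ q
    connected (tri j) (old v) _ v≢x U≢A U≢B _ V≢B =
      let (w , w≢x , w≢b , q) = enter j U≢A U≢B in
      q ++ old-walk (connG x b₀ w v w≢x w≢b v≢x (old≢b₀ v≢x V≢B))

  connectedRoles : ∀ A B U V → Valid A → Valid B → Valid U → Valid V →
    U ≢ A → U ≢ B → V ≢ A → V ≢ B → RoleWalk A B U V
  connectedRoles (old a) (old b) U V vA vB = AvoidingOld.connected a b vA vB U V
  connectedRoles (tri i) B       U V vA vB = AvoidingTri.connected i B vB U V
  connectedRoles (old a) (tri j) U V vA vB vU vV U≢A U≢B V≢A V≢B =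
    swap (AvoidingTri.connected j (old a) vA U V vU vV U≢B U≢A V≢B V≢A)

  connectedMinus₂ : ConnectedMinus₂ (YΔ G x y)
  connectedMinus₂ a b u v u≢a u≢b v≢a v≢b = subst₂ (WalkMinus₂ (YΔ G x y) a b) (embed-role u) (embed-role v)
    (toWalk (role-valid u) (connectedRoles (role x a) (role x b) (role x u) (role x v)
      (role-valid a) (role-valid b) (role-valid u) (role-valid v)
      (u≢a ∘ role-injective) (u≢b ∘ role-injective) (v≢a ∘ role-injective) (v≢b ∘ role-injective)))

module YΔ-Bicritical (G : Graph) (x : Fin (size G)) (y : Fin 3 → Fin (size G))
    (isG : IsGraph G) (nbrs : Nbrs G x y) (bicG : Bicritical G) where
  open YΔ-Roles G x y
  open Properties isG nbrs

  Matched : Role n → Role n → (Role n → Role n) → Role n → Set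
  Matched S T P W = Valid (P W) × P W ≢ S × P W ≢ T × P W ≢ W × P (P W) ≡ W × 1 ≤ M W (P W)

  RoleMatching : Role n → Role n → Set
  RoleMatching S T = Σ (Role n → Role n) λ P → ∀ W → Valid W → W ≢ S → W ≢ T → Matched S T P W

  RoleMatching-sym : ∀ {S T} → RoleMatching S T → RoleMatching T S
  RoleMatching-sym (P , ok) = P , λ W vW W≢S W≢T →
    let (v , ≢S , ≢T , ≢W , inv , adj) = ok W vW W≢T W≢S in v , ≢T , ≢S , ≢W , inv , adj

  -- In a perfect matching of G - s - t, x has a partner z = y i; give z to the corner tri i instead
  -- and pair up the other two corners.
  matching-old-old : ∀ s t → s ≢ x → t ≢ x → s ≢ t → RoleMatching (old s) (old t)
  matching-old-old s t s≢x t≢x s≢t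
    with p , ok ← proj₂ bicG s t s≢t
    with z≢s , z≢t , z≢x , pz≡x , xz ← ok x (s≢x ∘ sym) (t≢x ∘ sym)
    with i , yi≡z ← neighbour (p x) xz = P , matched
    where
    z = p x
    P : Role n → Role n
    P (old a) = ifDec (a ≟ z) (tri i) (old (p a))
    P (tri j) = ifDec (j ≟ i) (old z) (tri (third i j))
    matched : ∀ W → Valid W → W ≢ old s → W ≢ old t → Matched (old s) (old t) P W
    matched (old a) a≢x W≢s W≢t with a ≟ z
    ... | yes refl = tt , (λ ()) , (λ ()) , (λ ()) , ifDec-yes (i ≟ i) refl , old-tri yi≡z
    ... | no a≢z with ok a (W≢s ∘ cong old) (W≢t ∘ cong old)
    ...   | pa≢s , pa≢t , pa≢a , ppa≡a , adj =
      (λ pa≡x → a≢z (trans (sym ppa≡a) (cong p pa≡x))) , pa≢s ∘ old-injective , pa≢t ∘ old-injective ,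
      pa≢a ∘ old-injective , back , adj
      where
      back : ifDec (p a ≟ z) (tri i) (old (p (p a))) ≡ old a
      back with p a ≟ z
      ... | yes pa≡z = contradiction (trans (sym ppa≡a) (trans (cong p pa≡z) pz≡x)) a≢x
      ... | no _     = cong old ppa≡a
    matched (tri j) _ W≢s W≢t with j ≟ i
    ... | yes refl = z≢x , z≢s ∘ old-injective , z≢t ∘ old-injective , (λ ()) , ifDec-yes (z ≟ z) refl , tri-old yi≡z
    ... | no j≢i = tt , (λ ()) , (λ ()) , third-≢ʳ i j i≢j ∘ tri-injective , back , tri-tri (third-≢ʳ i j i≢j ∘ sym)
      where
      i≢j = j≢i ∘ sym
      back : ifDec (third i j ≟ i) (old z) (tri (third i (third i j))) ≡ tri j
      back = trans (ifDec-no (third i j ≟ i) (third-≢ˡ i j i≢j)) (cong tri (third-involutive i j i≢j))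

  -- Match G - s - x, and pair up the two corners other than i.
  matching-old-tri : ∀ s i → s ≢ x → RoleMatching (old s) (tri i)
  matching-old-tri s i s≢x = P , matched
    where
    p  = proj₁ (proj₂ bicG s x s≢x)
    ok = proj₂ (proj₂ bicG s x s≢x)
    P : Role n → Role n
    P (old a) = old (p a)
    P (tri j) = tri (third i j)
    matched : ∀ W → Valid W → W ≢ old s → W ≢ tri i → Matched (old s) (tri i) P W
    matched (old a) a≢x W≢s _ with ok a (W≢s ∘ cong old) a≢x
    ... | pa≢s , pa≢x , pa≢a , ppa≡a , adj = pa≢x , pa≢s ∘ old-injective , (λ ()) , pa≢a ∘ old-injective , cong old ppa≡a , adj
    matched (tri j) _ _ W≢i = tt , (λ ()) , third-≢ˡ i j i≢j ∘ tri-injective , third-≢ʳ i j i≢j ∘ tri-injective ,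
        cong tri (third-involutive i j i≢j) , tri-tri (third-≢ʳ i j i≢j ∘ sym)
      where
      i≢j : i ≢ j
      i≢j e = W≢i (cong tri (sym e))

  -- With k the third corner, match G - x - y k and add the edge between tri k and y k.
  matching-tri-tri : ∀ i j → i ≢ j → RoleMatching (tri i) (tri j)
  matching-tri-tri i j i≢j = P , matched
    where
    k = third i j
    z = y k
    p  = proj₁ (proj₂ bicG x z (y≢x k ∘ sym))
    ok = proj₂ (proj₂ bicG x z (y≢x k ∘ sym))
    P : Role n → Role n
    P (old a) = ifDec (a ≟ z) (tri k) (old (p a))
    P (tri l) = ifDec (l ≟ k) (old z) (tri l)
    matched : ∀ W → Valid W → W ≢ tri i → W ≢ tri j → Matched (tri i) (tri j) P W
    matched (old a) a≢x _ _ with a ≟ z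
    ... | yes refl = tt , third-≢ˡ i j i≢j ∘ tri-injective , third-≢ʳ i j i≢j ∘ tri-injective , (λ ()) ,
                     ifDec-yes (k ≟ k) refl , old-tri refl
    ... | no a≢z with ok a a≢x a≢z
    ...   | pa≢x , pa≢z , pa≢a , ppa≡a , adj =
      pa≢x , (λ ()) , (λ ()) , pa≢a ∘ old-injective , trans (ifDec-no (p a ≟ z) pa≢z) (cong old ppa≡a) , adj
    matched (tri l) _ W≢i W≢j with l ≟ k
    ... | yes refl = y≢x l , (λ ()) , (λ ()) , (λ ()) , ifDec-yes (z ≟ z) refl , tri-old refl
    ... | no l≢k = contradiction (third-unique i j l i≢j (W≢i ∘ cong tri) (W≢j ∘ cong tri)) l≢k

  roleMatching : ∀ S T → Valid S → Valid T → S ≢ T → RoleMatching S T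
  roleMatching (old s) (old t) s≢x t≢x S≢T = matching-old-old s t s≢x t≢x (S≢T ∘ cong old)
  roleMatching (old s) (tri i) s≢x _   _   = matching-old-tri s i s≢x
  roleMatching (tri i) (old t) _   t≢x _   = RoleMatching-sym (matching-old-tri t i t≢x)
  roleMatching (tri i) (tri j) _   _   S≢T = matching-tri-tri i j (S≢T ∘ cong tri)

  bicritical : Bicritical (YΔ G x y)
  bicritical = ≤-trans (proj₁ bicG) (m≤m+n n 2) , λ s t s≢t →
    perfectMatching s t (roleMatching (role x s) (role x t) (role-valid s) (role-valid t) (s≢t ∘ role-injective))
    where
    perfectMatching : ∀ s t → RoleMatching (role x s) (role x t) → PMMinus2 (YΔ G x y) s t
    perfectMatching s t (P , ok) = embed ∘ P ∘ role x , λ w w≢s w≢t →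
      let (v , ≢S , ≢T , ≢W , inv , adj) = ok (role x w) (role-valid w) (w≢s ∘ role-injective) (w≢t ∘ role-injective)
          r≡ = role-embed (P (role x w)) v
          ≢ : ∀ {R} → P (role x w) ≢ role x R → embed (P (role x w)) ≢ R
          ≢ ne e = ne (trans (sym r≡) (cong (role x) e)) in
      ≢ ≢S , ≢ ≢T , ≢ ≢W , trans (cong (embed ∘ P) r≡) (trans (cong embed inv) (embed-role w)) ,
      subst (1 ≤_) (cong (M (role x w)) (sym r≡)) adj

module YΔ-Triangles (G : Graph) (x : Fin (size G)) (y : Fin 3 → Fin (size G))
    (isG : IsGraph G) (nbrs : Nbrs G x y) (y-injective : ∀ i j → y i ≡ y j → i ≡ j) where
  open YΔ-Roles G x y
  open Properties isG nbrs

  AllOld AllTri : Role n → Role n → Role n → Set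
  AllOld R₁ R₂ R₃ = ∃[ a ] ∃[ b ] ∃[ c ] R₁ ≡ old a × R₂ ≡ old b × R₃ ≡ old c
  AllTri R₁ R₂ R₃ = ∃[ i ] ∃[ j ] ∃[ k ] R₁ ≡ tri i × R₂ ≡ tri j × R₃ ≡ tri k

  -- Each old vertex sees at most one corner of the new triangle, and each corner only one old vertex.
  triangle-roles : ∀ R₁ R₂ R₃ → R₁ ≢ R₂ → R₂ ≢ R₃ → R₁ ≢ R₃ →
    1 ≤ M R₁ R₂ → 1 ≤ M R₂ R₃ → 1 ≤ M R₁ R₃ → AllOld R₁ R₂ R₃ ⊎ AllTri R₁ R₂ R₃
  triangle-roles (old a) (old b) (old c) _ _ _ _ _ _ = inj₁ (a , b , c , refl , refl , refl)
  triangle-roles (tri i) (tri j) (tri k) _ _ _ _ _ _ = inj₂ (i , j , k , refl , refl , refl)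
  triangle-roles (old a) (old b) (tri k) ≢₁₂ _ _ _ h₂₃ h₁₃ = contradiction (cong old (trans (sym (old-tri⁻ h₁₃)) (old-tri⁻ h₂₃))) ≢₁₂
  triangle-roles (old a) (tri j) (old c) _ _ ≢₁₃ h₁₂ h₂₃ _ = contradiction (cong old (trans (sym (old-tri⁻ h₁₂)) (tri-old⁻ h₂₃))) ≢₁₃
  triangle-roles (tri i) (old b) (old c) _ ≢₂₃ _ h₁₂ _ h₁₃ = contradiction (cong old (trans (sym (tri-old⁻ h₁₂)) (tri-old⁻ h₁₃))) ≢₂₃
  triangle-roles (old a) (tri j) (tri k) _ ≢₂₃ _ h₁₂ _ h₁₃ = contradiction (cong tri (y-injective j k (trans (old-tri⁻ h₁₂) (sym (old-tri⁻ h₁₃))))) ≢₂₃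
  triangle-roles (tri i) (old b) (tri k) _ _ ≢₁₃ h₁₂ h₂₃ _ = contradiction (cong tri (y-injective i k (trans (tri-old⁻ h₁₂) (sym (old-tri⁻ h₂₃))))) ≢₁₃
  triangle-roles (tri i) (tri j) (old c) ≢₁₂ _ _ _ h₂₃ h₁₃ = contradiction (cong tri (y-injective i j (trans (tri-old⁻ h₁₃) (sym (tri-old⁻ h₂₃))))) ≢₁₂

  module _ (T : Triangle (YΔ G x y)) where
    open Triangle T

    classify : AllOld (role x a) (role x b) (role x c) ⊎ AllTri (role x a) (role x b) (role x c)
    classify = triangle-roles (role x a) (role x b) (role x c)
      (a≢b ∘ role-injective) (b≢c ∘ role-injective) (a≢c ∘ role-injective) ab bc ac

  IsTri : Role n → Set
  IsTri (old _) = ⊥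
  IsTri (tri _) = ⊤

  collapse-role↑ˡ : ∀ a → collapse (role↑ˡ a) ≡ a
  collapse-role↑ˡ = role↑ˡ-elim (λ a r → collapse r ≡ a) refl (λ _ _ → refl)

  Σfin-collapse : ∀ (F : Role n → ℕ) p →
    Σfin (n + 2) (λ u → ind (collapse (role x u) ≟ p) * F (role x u)) ≡
    F (role↑ˡ p) + ind (x ≟ p) * (F (tri (suc zero)) + (F (tri (suc (suc zero))) + 0))
  Σfin-collapse F p = trans (Σfin-role (λ r → ind (collapse r ≟ p) * F r))
    (cong₂ _+_ (trans (Σfin-cong n (λ a → cong (λ z → ind (z ≟ p) * F (role↑ˡ a)) (collapse-role↑ˡ a)))
                      (Σfin-ind n p (F ∘ role↑ˡ)))
               (distrib (ind (x ≟ p)) (F (tri (suc zero))) (F (tri (suc (suc zero))))))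
    where
    distrib : ∀ c a b → c * a + (c * b + 0) ≡ c * (a + (b + 0))
    distrib = solve 3 (λ c a b → c :* a :+ (c :* b :+ con 0) := c :* (a :+ (b :+ con 0))) refl

  -- Contracting the new triangle collapses every role onto its vertex of G, undoing the operation.
  module NewTriangle (T : Triangle (YΔ G x y)) (i j k : Fin 3) (ea : role x (Triangle.a T) ≡ tri i)
      (eb : role x (Triangle.b T) ≡ tri j) (ec : role x (Triangle.c T) ≡ tri k) where
    open Triangle T

    tri≢ : ∀ {u v l m} → u ≢ v → role x u ≡ tri l → role x v ≡ tri m → l ≢ m
    tri≢ u≢v eu ev e = u≢v (role-injective (trans eu (trans (cong tri e) (sym ev))))

    inT⇒IsTri : ∀ u → InT T u → IsTri (role x u)
    inT⇒IsTri u (inj₁ refl)        = subst IsTri (sym ea) tt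
    inT⇒IsTri u (inj₂ (inj₁ refl)) = subst IsTri (sym eb) tt
    inT⇒IsTri u (inj₂ (inj₂ refl)) = subst IsTri (sym ec) tt

    IsTri⇒inT : ∀ u → IsTri (role x u) → InT T u
    IsTri⇒inT u t = lemma (role x u) refl t
      where
      lemma : ∀ R → role x u ≡ R → IsTri R → InT T u
      lemma (tri l) e _ with Fin3-cover (tri≢ a≢b ea eb) (tri≢ b≢c eb ec) (tri≢ a≢c ea ec) l
      ... | inj₁ refl        = inj₁ (role-injective (trans e (sym ea)))
      ... | inj₂ (inj₁ refl) = inj₂ (inj₁ (role-injective (trans e (sym eb))))
      ... | inj₂ (inj₂ refl) = inj₂ (inj₂ (role-injective (trans e (sym ec))))

    squash : Fin (n + 2) → Fin n
    squash = collapse ∘ role x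

    fibres⁻ : ∀ u v → squash u ≡ squash v → u ≡ v ⊎ (InT T u × InT T v)
    fibres⁻ u v = lemma (role x u) (role x v) refl refl (role-valid u) (role-valid v)
      where
      lemma : ∀ R S → role x u ≡ R → role x v ≡ S → Valid R → Valid S → collapse R ≡ collapse S →
        u ≡ v ⊎ (InT T u × InT T v)
      lemma (old a) (old b) eu ev _ _ refl = inj₁ (role-injective (trans eu (sym ev)))
      lemma (old a) (tri _) _ _ a≢x _ e = contradiction e a≢x
      lemma (tri _) (old b) _ _ _ b≢x e = contradiction (sym e) b≢x
      lemma (tri _) (tri _) eu ev _ _ _ = inj₂ (IsTri⇒inT u (subst IsTri (sym eu) tt) , IsTri⇒inT v (subst IsTri (sym ev) tt))

    fibres⁺ : ∀ u v → u ≡ v ⊎ (InT T u × InT T v) → squash u ≡ squash v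
    fibres⁺ u v (inj₁ refl)       = refl
    fibres⁺ u v (inj₂ (u∈ , v∈)) = lemma (role x u) (role x v) (inT⇒IsTri u u∈) (inT⇒IsTri v v∈)
      where
      lemma : ∀ R S → IsTri R → IsTri S → collapse R ≡ collapse S
      lemma (tri _) (tri _) _ _ = refl

    edges : ∀ p q → p ≢ q → mult G p q ≡
      Σfin (n + 2) (λ u → Σfin (n + 2) (λ v → ind (squash u ≟ p) * ind (squash v ≟ q) * mult (YΔ G x y) u v))
    edges p q p≢q = sym (begin
      Σfin (n + 2) (λ u → Σfin (n + 2) (λ v → ind (squash u ≟ p) * ind (squash v ≟ q) * M (role x u) (role x v)))
        ≡⟨ Σfin²-factor (n + 2) (n + 2) (λ u → ind (squash u ≟ p)) (λ v → ind (squash v ≟ q)) (λ u v → M (role x u) (role x v)) ⟩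
      Σfin (n + 2) (λ u → ind (squash u ≟ p) * Σfin (n + 2) (λ v → ind (squash v ≟ q) * M (role x u) (role x v)))
        ≡⟨ Σfin-cong (n + 2) (λ u → cong (ind (squash u ≟ p) *_) (Σfin-collapse (M (role x u)) q)) ⟩
      Σfin (n + 2) (λ u → ind (squash u ≟ p) * Row (role x u))
        ≡⟨ Σfin-collapse Row p ⟩
      Row (role↑ˡ p) + ind (x ≟ p) * (Row (tri (suc zero)) + (Row (tri (suc (suc zero))) + 0))
        ≡⟨ cases (p ≟ x) (q ≟ x) ⟩
      mult G p q ∎)
      where
      open ≡-Reasoning
      i₀ i₁ i₂ : Fin n → ℕ
      i₀ v = ind (y zero ≟ v)
      i₁ v = ind (y (suc zero) ≟ v)
      i₂ v = ind (y (suc (suc zero)) ≟ v)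
      Row : Role n → ℕ
      Row R = M R (role↑ˡ q) + ind (x ≟ q) * (M R (tri (suc zero)) + (M R (tri (suc (suc zero))) + 0))
      cases : Dec (p ≡ x) → Dec (q ≡ x) →
        Row (role↑ˡ p) + ind (x ≟ p) * (Row (tri (suc zero)) + (Row (tri (suc (suc zero))) + 0)) ≡ mult G p q
      cases (yes refl) (yes refl) = contradiction refl p≢q
      cases (no p≢x) (no q≢x)
        rewrite role↑ˡ-old p≢x | role↑ˡ-old q≢x | ind-no (x ≟ q) (q≢x ∘ sym) | ind-no (x ≟ p) (p≢x ∘ sym)
        = trans (+-identityʳ _) (+-identityʳ _)
      cases (yes refl) (no q≢x)
        rewrite role↑ˡ-x | role↑ˡ-old q≢x | ind-no (x ≟ q) (q≢x ∘ sym) | ind-yes (x ≟ x) refl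
        = trans (solve 3 (λ a b c → a :+ con 0 :+ (b :+ con 0 :+ (c :+ con 0 :+ con 0) :+ con 0) := a :+ b :+ c) refl (i₀ q) (i₁ q) (i₂ q))
                (sym (nbrs q))
      cases (no p≢x) (yes refl)
        rewrite role↑ˡ-x | role↑ˡ-old p≢x | ind-no (x ≟ p) (p≢x ∘ sym) | ind-yes (x ≟ x) refl
        = trans (solve 3 (λ a b c → a :+ (b :+ (c :+ con 0) :+ con 0) :+ con 0 := a :+ b :+ c) refl (i₀ p) (i₁ p) (i₂ p))
                (trans (sym (nbrs p)) (IsGraph.symmetric isG x p))

    contraction : Contraction (YΔ G x y) T G
    contraction = record
      { f       = squash
      ; onto    = λ q → q ↑ˡ 2 , λ e → trans (cong squash e) (collapse-role↑ˡ q)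
      ; fibres  = λ u v → fibres⁻ u v , fibres⁺ u v
      ; edges   = edges
      ; noLoops = IsGraph.loopless isG
      }

  module OldTriangle (T : Triangle (YΔ G x y)) (a₀ b₀ c₀ : Fin n) (ea : role x (Triangle.a T) ≡ old a₀)
      (eb : role x (Triangle.b T) ≡ old b₀) (ec : role x (Triangle.c T) ≡ old c₀) where
    open Triangle T

    a₀≢x : a₀ ≢ x
    a₀≢x = subst Valid ea (role-valid a)
    b₀≢x : b₀ ≢ x
    b₀≢x = subst Valid eb (role-valid b)
    c₀≢x : c₀ ≢ x
    c₀≢x = subst Valid ec (role-valid c)

    old≢ : ∀ {u v a′ b′} → u ≢ v → role x u ≡ old a′ → role x v ≡ old b′ → a′ ≢ b′
    old≢ u≢v eu ev e = u≢v (role-injective (trans eu (trans (cong old e) (sym ev))))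

    T₀ : Triangle G
    T₀ = triangle a₀ b₀ c₀ (old≢ a≢b ea eb) (old≢ b≢c eb ec) (old≢ a≢c ea ec)
      (subst (1 ≤_) (cong₂ M ea eb) ab) (subst (1 ≤_) (cong₂ M eb ec) bc) (subst (1 ≤_) (cong₂ M ea ec) ac)

    inT⁻ : ∀ u → InT T u → ∃[ w ] role x u ≡ old w × InT T₀ w
    inT⁻ u (inj₁ refl)        = a₀ , ea , inj₁ refl
    inT⁻ u (inj₂ (inj₁ refl)) = b₀ , eb , inj₂ (inj₁ refl)
    inT⁻ u (inj₂ (inj₂ refl)) = c₀ , ec , inj₂ (inj₂ refl)

    inT⁺ : ∀ u w → role x u ≡ old w → InT T₀ w → InT T u
    inT⁺ u w e (inj₁ refl)        = inj₁ (role-injective (trans e (sym ea)))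
    inT⁺ u w e (inj₂ (inj₁ refl)) = inj₂ (inj₁ (role-injective (trans e (sym eb))))
    inT⁺ u w e (inj₂ (inj₂ refl)) = inj₂ (inj₂ (role-injective (trans e (sym ec))))

    T₀∌x : ∀ w → InT T₀ w → w ≢ x
    T₀∌x w (inj₁ refl)        = a₀≢x
    T₀∌x w (inj₂ (inj₁ refl)) = b₀≢x
    T₀∌x w (inj₂ (inj₂ refl)) = c₀≢x

    -- T avoids the new triangle, so contracting it commutes with the Y→Δ-operation on x.
    module Contract (K : Graph) (C : Contraction G T₀ K) where
      module C = Contraction C
      m = size K
      f = C.f
      x′ : Fin m
      x′ = f x
      y′ : Fin 3 → Fin m
      y′ = f ∘ y
      module R′ = YΔ-Roles K x′ y′

      f-x : ∀ u → f u ≡ x′ → u ≡ x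
      f-x u e with proj₁ (C.fibres u x) e
      ... | inj₁ u≡x      = u≡x
      ... | inj₂ (_ , x∈) = contradiction refl (T₀∌x x x∈)

      f-≢x′ : ∀ {b} → b ≢ x′ → ind (x′ ≟ b) ≡ 0
      f-≢x′ {b} b≢x′ = ind-no (x′ ≟ b) (b≢x′ ∘ sym)

      liftRole : Role n → Role m
      liftRole (old a) = old (f a)
      liftRole (tri i) = tri i

      liftRole-valid : ∀ R → Valid R → R′.Valid (liftRole R)
      liftRole-valid (old a) a≢x e = a≢x (f-x a e)
      liftRole-valid (tri i) _     = tt

      squash : Fin (n + 2) → Fin (m + 2)
      squash = R′.embed ∘ liftRole ∘ role x

      ind-squash : ∀ u p → ind (squash u ≟ p) ≡ ind (liftRole (role x u) ≟R role x′ p)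
      ind-squash u p = ind-cong (squash u ≟ p) (liftRole (role x u) ≟R role x′ p)
        (λ e → trans (sym (R′.role-embed _ (liftRole-valid _ (role-valid u)))) (cong (role x′) e))
        (λ e → trans (cong R′.embed e) (R′.embed-role p))

      fibreSum : Role m → (Role n → ℕ) → ℕ
      fibreSum (old b) F = Σfin n (λ a → ind (f a ≟ b) * F (role↑ˡ a))
      fibreSum (tri i) F = F (tri i)

      Σfin-fibre : ∀ (F : Role n → ℕ) P → R′.Valid P →
        Σfin (n + 2) (λ u → ind (liftRole (role x u) ≟R P) * F (role x u)) ≡ fibreSum P F
      Σfin-fibre F (old b) b≢x′ = trans (Σfin-role (λ r → ind (liftRole r ≟R old b) * F r))
        (trans (+-identityʳ _) (Σfin-cong n (role↑ˡ-elim (λ a r → ind (liftRole r ≟R old b) * F r ≡ ind (f a ≟ b) * F r)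
          (cong (_* F (tri zero)) (sym (f-≢x′ b≢x′)))
          (λ a _ → cong (_* F (old a)) (ind-cong (old (f a) ≟R old b) (f a ≟ b) old-injective (cong old))))))
      Σfin-fibre F (tri i) _ = begin
        Σfin (n + 2) (λ u → ind (liftRole (role x u) ≟R tri i) * F (role x u))
          ≡⟨ Σfin-role (λ r → ind (liftRole r ≟R tri i) * F r) ⟩
        Σfin n (λ a → ind (liftRole (role↑ˡ a) ≟R tri i) * F (role↑ˡ a)) + (t (suc zero) + (t (suc (suc zero)) + 0))
          ≡⟨ cong (_+ (t (suc zero) + (t (suc (suc zero)) + 0))) (trans (Σfin-cong n pointwise) (Σfin-ind n x (λ _ → t zero))) ⟩
        t zero + (t (suc zero) + (t (suc (suc zero)) + 0))
          ≡⟨ corner i ⟩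
        F (tri i) ∎
        where
        open ≡-Reasoning
        t : Fin 3 → ℕ
        t l = ind (tri {m} l ≟R tri i) * F (tri l)
        pointwise : ∀ a → ind (liftRole (role↑ˡ a) ≟R tri i) * F (role↑ˡ a) ≡ ind (a ≟ x) * t zero
        pointwise = role↑ˡ-elim (λ a r → ind (liftRole r ≟R tri i) * F r ≡ ind (a ≟ x) * t zero)
          (sym (trans (cong (_* t zero) (ind-yes (x ≟ x) refl)) (+-identityʳ (t zero))))
          (λ a a≢x → cong (_* t zero) (sym (ind-no (a ≟ x) a≢x)))
        corner : ∀ i → ind (tri {m} zero ≟R tri i) * F (tri zero) + (ind (tri {m} (suc zero) ≟R tri i) * F (tri (suc zero)) +
                         (ind (tri {m} (suc (suc zero)) ≟R tri i) * F (tri (suc (suc zero))) + 0)) ≡ F (tri i)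
        corner zero             = solve 3 (λ a b c → con 1 :* a :+ (con 0 :* b :+ (con 0 :* c :+ con 0)) := a) refl (F (tri zero)) (F (tri (suc zero))) (F (tri (suc (suc zero))))
        corner (suc zero)       = solve 3 (λ a b c → con 0 :* a :+ (con 1 :* b :+ (con 0 :* c :+ con 0)) := b) refl (F (tri zero)) (F (tri (suc zero))) (F (tri (suc (suc zero))))
        corner (suc (suc zero)) = solve 3 (λ a b c → con 0 :* a :+ (con 0 :* b :+ (con 1 :* c :+ con 0)) := c) refl (F (tri zero)) (F (tri (suc zero))) (F (tri (suc (suc zero))))

      fibreSum-tri : ∀ i c → c ≢ x′ → fibreSum (old c) (M (tri i)) ≡ ind (y′ i ≟ c)
      fibreSum-tri i c c≢x′ = trans (Σfin-cong n pointwise) (Σfin-ind n (y i) (λ a → ind (f a ≟ c)))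
        where
        pointwise : ∀ a → ind (f a ≟ c) * M (tri i) (role↑ˡ a) ≡ ind (a ≟ y i) * ind (f a ≟ c)
        pointwise = role↑ˡ-elim (λ a r → ind (f a ≟ c) * M (tri i) r ≡ ind (a ≟ y i) * ind (f a ≟ c))
          (trans (cong (_* _) (f-≢x′ c≢x′)) (sym (trans (cong (ind (x ≟ y i) *_) (f-≢x′ c≢x′)) (*-zeroʳ (ind (x ≟ y i))))))
          (λ a _ → trans (*-comm (ind (f a ≟ c)) _) (cong (_* ind (f a ≟ c)) (ind-sym (y i) a)))

      fibreSum-old : ∀ b c → b ≢ x′ → c ≢ x′ →
        fibreSum (old b) (λ R → fibreSum (old c) (M R)) ≡ Σfin n (λ a → ind (f a ≟ b) * Σfin n (λ a′ → ind (f a′ ≟ c) * mult G a a′))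
      fibreSum-old b c b≢x′ c≢x′ = Σfin-cong n (role↑ˡ-elim
        (λ a r → ind (f a ≟ b) * fibreSum (old c) (M r) ≡ ind (f a ≟ b) * Σfin n (λ a′ → ind (f a′ ≟ c) * mult G a a′))
        (cong (_* _) (f-≢x′ b≢x′) ∙ sym (cong (_* _) (f-≢x′ b≢x′)))
        (λ a _ → cong (ind (f a ≟ b) *_) (Σfin-cong n (role↑ˡ-elim
           (λ a′ r → ind (f a′ ≟ c) * M (old a) r ≡ ind (f a′ ≟ c) * mult G a a′)
           (cong (_* _) (f-≢x′ c≢x′) ∙ sym (cong (_* _) (f-≢x′ c≢x′)))
           (λ _ _ → refl)))))
        where
        _∙_ = trans

      fibreSum-M : ∀ P Q → R′.Valid P → R′.Valid Q → P ≢ Q → fibreSum P (λ R → fibreSum Q (M R)) ≡ R′.M P Q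
      fibreSum-M (tri i) (tri j) _   _   _   = refl
      fibreSum-M (tri i) (old c) _   c≢x′ _  = fibreSum-tri i c c≢x′
      fibreSum-M (old b) (tri j) b≢x′ _  _   =
        trans (Σfin-cong n (λ a → cong (ind (f a ≟ b) *_) (M-sym (role↑ˡ a) (tri j)))) (fibreSum-tri j b b≢x′)
      fibreSum-M (old b) (old c) b≢x′ c≢x′ P≢Q = begin
        fibreSum (old b) (λ R → fibreSum (old c) (M R))
          ≡⟨ fibreSum-old b c b≢x′ c≢x′ ⟩
        Σfin n (λ a → ind (f a ≟ b) * Σfin n (λ a′ → ind (f a′ ≟ c) * mult G a a′))
          ≡⟨ sym (Σfin²-factor n n (λ a → ind (f a ≟ b)) (λ a′ → ind (f a′ ≟ c)) (mult G)) ⟩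
        Σfin n (λ a → Σfin n (λ a′ → ind (f a ≟ b) * ind (f a′ ≟ c) * mult G a a′))
          ≡⟨ sym (C.edges b c (P≢Q ∘ cong old)) ⟩
        mult K b c ∎
        where open ≡-Reasoning

      edges : ∀ p q → p ≢ q → mult (YΔ K x′ y′) p q ≡
        Σfin (n + 2) (λ u → Σfin (n + 2) (λ v → ind (squash u ≟ p) * ind (squash v ≟ q) * mult (YΔ G x y) u v))
      edges p q p≢q = sym (begin
        Σfin (n + 2) (λ u → Σfin (n + 2) (λ v → ind (squash u ≟ p) * ind (squash v ≟ q) * M (role x u) (role x v)))
          ≡⟨ Σfin²-factor (n + 2) (n + 2) (λ u → ind (squash u ≟ p)) (λ v → ind (squash v ≟ q)) (λ u v → M (role x u) (role x v)) ⟩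
        Σfin (n + 2) (λ u → ind (squash u ≟ p) * Σfin (n + 2) (λ v → ind (squash v ≟ q) * M (role x u) (role x v)))
          ≡⟨ Σfin-cong (n + 2) (λ u → cong₂ _*_ (ind-squash u p)
               (trans (Σfin-cong (n + 2) (λ v → cong (_* M (role x u) (role x v)) (ind-squash v q)))
                      (Σfin-fibre (M (role x u)) (role x′ q) (R′.role-valid q)))) ⟩
        Σfin (n + 2) (λ u → ind (liftRole (role x u) ≟R role x′ p) * fibreSum (role x′ q) (M (role x u)))
          ≡⟨ Σfin-fibre (λ R → fibreSum (role x′ q) (M R)) (role x′ p) (R′.role-valid p) ⟩
        fibreSum (role x′ p) (λ R → fibreSum (role x′ q) (M R))
          ≡⟨ fibreSum-M (role x′ p) (role x′ q) (R′.role-valid p) (R′.role-valid q) (p≢q ∘ R′.role-injective) ⟩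
        R′.M (role x′ p) (role x′ q) ∎)
        where open ≡-Reasoning

      onto : ∀ q → ∃[ u ] (∀ {z} → z ≡ u → squash z ≡ q)
      onto q = lemma (role x′ q) refl (R′.role-valid q)
        where
        hits : ∀ R → Valid R → liftRole R ≡ role x′ q → ∀ {z} → z ≡ embed R → squash z ≡ q
        hits R vR e refl = trans (cong (R′.embed ∘ liftRole) (role-embed R vR)) (trans (cong R′.embed e) (R′.embed-role q))
        lemma : ∀ Q → role x′ q ≡ Q → R′.Valid Q → ∃[ u ] (∀ {z} → z ≡ u → squash z ≡ q)
        lemma (tri i) e _ = embed (tri i) , hits (tri i) tt (sym e)
        lemma (old b) e b≢x′ = embed (old w) , hits (old w) w≢x (trans (cong old (proj₂ (C.onto b) refl)) (sym e))
          where
          w = proj₁ (C.onto b)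
          w≢x : w ≢ x
          w≢x w≡x = b≢x′ (trans (sym (proj₂ (C.onto b) refl)) (cong f w≡x))

      fibres⁻ : ∀ u v → squash u ≡ squash v → u ≡ v ⊎ (InT T u × InT T v)
      fibres⁻ u v e = lemma (role x u) (role x v) refl refl
        (R′.embed-injective (liftRole-valid _ (role-valid u)) (liftRole-valid _ (role-valid v)) e)
        where
        lemma : ∀ R S → role x u ≡ R → role x v ≡ S → liftRole R ≡ liftRole S → u ≡ v ⊎ (InT T u × InT T v)
        lemma (old a) (old b) eu ev e′ with proj₁ (C.fibres a b) (old-injective e′)
        ... | inj₁ refl        = inj₁ (role-injective (trans eu (sym ev)))
        ... | inj₂ (a∈ , b∈) = inj₂ (inT⁺ u a eu a∈ , inT⁺ v b ev b∈)
        lemma (tri i) (tri j) eu ev refl = inj₁ (role-injective (trans eu (sym ev)))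

      fibres⁺ : ∀ u v → u ≡ v ⊎ (InT T u × InT T v) → squash u ≡ squash v
      fibres⁺ u v (inj₁ refl) = refl
      fibres⁺ u v (inj₂ (u∈ , v∈))
        with w₁ , e₁ , w₁∈ ← inT⁻ u u∈
        with w₂ , e₂ , w₂∈ ← inT⁻ v v∈ =
        trans (cong (R′.embed ∘ liftRole) e₁)
          (trans (cong (R′.embed ∘ old) (proj₂ (C.fibres w₁ w₂) (inj₂ (w₁∈ , w₂∈)))) (cong (R′.embed ∘ liftRole) (sym e₂)))

      noLoops : ∀ p → mult (YΔ K x′ y′) p p ≡ 0
      noLoops p = lemma (role x′ p)
        where
        lemma : ∀ P → R′.M P P ≡ 0
        lemma (old b) = C.noLoops b
        lemma (tri i) = nind-yes (i ≟ i) refl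

      contraction : Contraction (YΔ G x y) T (YΔ K x′ y′)
      contraction = record { f = squash ; onto = onto ; fibres = λ u v → fibres⁻ u v , fibres⁺ u v ; edges = edges ; noLoops = noLoops }

      nbrs′ : Nbrs K x′ y′
      nbrs′ v with v ≟ x′
      ... | yes refl = trans (C.noLoops x′) (sym countY-x′)
        where
        countY-x′ : countY y′ x′ ≡ 0
        countY-x′ rewrite ind-no (y′ zero ≟ x′) (y≢x zero ∘ f-x (y zero))
                               | ind-no (y′ (suc zero) ≟ x′) (y≢x (suc zero) ∘ f-x (y (suc zero)))
                               | ind-no (y′ (suc (suc zero)) ≟ x′) (y≢x (suc (suc zero)) ∘ f-x (y (suc (suc zero)))) = refl
      ... | no v≢x′ = begin
        mult K x′ v
          ≡⟨ C.edges x′ v (v≢x′ ∘ sym) ⟩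
        Σfin n (λ u → Σfin n (λ w → ind (f u ≟ x′) * ind (f w ≟ v) * mult G u w))
          ≡⟨ Σfin²-factor n n (λ u → ind (f u ≟ x′)) (λ w → ind (f w ≟ v)) (mult G) ⟩
        Σfin n (λ u → ind (f u ≟ x′) * S u)
          ≡⟨ Σfin-cong n (λ u → cong (_* S u) (ind-cong (f u ≟ x′) (u ≟ x) (f-x u) (cong f))) ⟩
        Σfin n (λ u → ind (u ≟ x) * S u)
          ≡⟨ Σfin-ind n x S ⟩
        S x
          ≡⟨ Σfin-cong n (λ w → trans (cong (ind (f w ≟ v) *_) (nbrs w))
               (distrib (ind (f w ≟ v)) (ind (y zero ≟ w)) (ind (y (suc zero) ≟ w)) (ind (y (suc (suc zero)) ≟ w)))) ⟩
        Σfin n (λ w → I zero w + I (suc zero) w + I (suc (suc zero)) w)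
          ≡⟨ Σfin-distrib-+ n (λ w → I zero w + I (suc zero) w) (I (suc (suc zero))) ⟩
        Σfin n (λ w → I zero w + I (suc zero) w) + Σfin n (I (suc (suc zero)))
          ≡⟨ cong (_+ Σfin n (I (suc (suc zero)))) (Σfin-distrib-+ n (I zero) (I (suc zero))) ⟩
        Σfin n (I zero) + Σfin n (I (suc zero)) + Σfin n (I (suc (suc zero)))
          ≡⟨ cong₂ _+_ (cong₂ _+_ (ΣI zero) (ΣI (suc zero))) (ΣI (suc (suc zero))) ⟩
        countY y′ v ∎
        where
        open ≡-Reasoning
        S : Fin n → ℕ
        S u = Σfin n (λ w → ind (f w ≟ v) * mult G u w)
        I : Fin 3 → Fin n → ℕ
        I l w = ind (f w ≟ v) * ind (y l ≟ w)
        ΣI : ∀ l → Σfin n (I l) ≡ ind (y′ l ≟ v)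
        ΣI l = trans (Σfin-cong n (λ w → trans (*-comm (ind (f w ≟ v)) _) (cong (_* ind (f w ≟ v)) (ind-sym (y l) w))))
                     (Σfin-ind n (y l) (λ w → ind (f w ≟ v)))
        distrib : ∀ c a b d → c * (a + b + d) ≡ c * a + c * b + c * d
        distrib = solve 4 (λ c a b d → c :* (a :+ b :+ d) := c :* a :+ c :* b :+ c :* d) refl

      y′-injective : NoDiamond G → ∀ i j → y′ i ≡ y′ j → i ≡ j
      y′-injective noDiamond i j e with proj₁ (C.fibres (y i) (y j)) e
      ... | inj₁ yi≡yj = y-injective i j yi≡yj
      ... | inj₂ (yi∈ , yj∈) with i ≟ j
      ...   | yes i≡j = i≡j
      ...   | no i≢j  = ⊥-elim (noDiamond T₀ x (y i) (y j) (λ x∈ → T₀∌x x x∈ refl) yi∈ yj∈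
                          (i≢j ∘ y-injective i j) (adjacent-y i) (adjacent-y j))

  IsTri-tri : ∀ R → IsTri R → ∃[ l ] R ≡ tri l
  IsTri-tri (tri l) _ = l , refl

  noDiamond : NoDiamondAvoiding G x → NoDiamond (YΔ G x y)
  noDiamond noDiamondG T d u v d∉T u∈T v∈T u≢v du dv with classify T
  ... | inj₁ (a₀ , b₀ , c₀ , ea , eb , ec) = oldCase (role x d) refl
    where
    open OldTriangle T a₀ b₀ c₀ ea eb ec
    U = inT⁻ u u∈T
    V = inT⁻ v v∈T
    eu = proj₁ (proj₂ U)
    ev = proj₁ (proj₂ V)
    oldCase : ∀ R → role x d ≡ R → ⊥
    oldCase (tri l) ed = u≢v (role-injective (trans eu (trans (cong old (trans (sym yl≡u) yl≡v)) (sym ev))))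
      where
      yl≡u = tri-old⁻ (subst (1 ≤_) (cong₂ M ed eu) du)
      yl≡v = tri-old⁻ (subst (1 ≤_) (cong₂ M ed ev) dv)
    oldCase (old d₀) ed = noDiamondG T₀ d₀ (proj₁ U) (proj₁ V) a₀≢x b₀≢x c₀≢x (subst Valid ed (role-valid d))
      (d∉T ∘ inT⁺ d d₀ ed) (proj₂ (proj₂ U)) (proj₂ (proj₂ V))
      (λ e → u≢v (role-injective (trans eu (trans (cong old e) (sym ev)))))
      (subst (1 ≤_) (cong₂ M ed eu) du) (subst (1 ≤_) (cong₂ M ed ev) dv)
  ... | inj₂ (i , j , k , ea , eb , ec) = newCase (role x d) refl
    where
    open NewTriangle T i j k ea eb ec
    U = IsTri-tri (role x u) (inT⇒IsTri u u∈T)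
    V = IsTri-tri (role x v) (inT⇒IsTri v v∈T)
    newCase : ∀ R → role x d ≡ R → ⊥
    newCase (tri l) ed = d∉T (IsTri⇒inT d (subst IsTri (sym ed) tt))
    newCase (old d₀) ed = u≢v (role-injective (trans (proj₂ U)
      (trans (cong tri (y-injective _ _ (trans yu≡d (sym yv≡d)))) (sym (proj₂ V)))))
      where
      yu≡d = old-tri⁻ (subst (1 ≤_) (cong₂ M ed (proj₂ U)) du)
      yv≡d = old-tri⁻ (subst (1 ≤_) (cong₂ M ed (proj₂ V)) dv)

no-five-distinct : ∀ (x a b c d : Fin 4) → a ≢ x → b ≢ x → c ≢ x → d ≢ x →
  a ≢ b → b ≢ c → a ≢ c → d ≢ a → d ≢ b → d ≢ c → ⊥
no-five-distinct = toWitness {a? = all? λ x → all? λ a → all? λ b → all? λ c → all? λ d →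
  ¬? (a ≟ x) →-dec ¬? (b ≟ x) →-dec ¬? (c ≟ x) →-dec ¬? (d ≟ x) →-dec ¬? (a ≟ b) →-dec ¬? (b ≟ c) →-dec
  ¬? (a ≟ c) →-dec ¬? (d ≟ a) →-dec ¬? (d ≟ b) →-dec ¬? (d ≟ c) →-dec no λ ()} tt

four-cover : ∀ (x a b c u : Fin 4) → a ≢ x → b ≢ x → c ≢ x → u ≢ x →
  a ≢ b → b ≢ c → a ≢ c → u ≡ a ⊎ u ≡ b ⊎ u ≡ c
four-cover = toWitness {a? = all? λ x → all? λ a → all? λ b → all? λ c → all? λ u →
  ¬? (a ≟ x) →-dec ¬? (b ≟ x) →-dec ¬? (c ≟ x) →-dec ¬? (u ≟ x) →-dec ¬? (a ≟ b) →-dec ¬? (b ≟ c) →-dec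
  ¬? (a ≟ c) →-dec (u ≟ a ⊎-dec u ≟ b ⊎-dec u ≟ c)} tt

-- for distinct s, t, w, the fourth vertex
fourth : Fin 4 → Fin 4 → Fin 4 → Fin 4
fourth s t w = ifDec (outside zero) zero (ifDec (outside (suc zero)) (suc zero) (ifDec (outside (suc (suc zero))) (suc (suc zero)) (suc (suc (suc zero)))))
  where
  outside : ∀ v → Dec (v ≢ s × v ≢ t × v ≢ w)
  outside v = ¬? (v ≟ s) ×-dec ¬? (v ≟ t) ×-dec ¬? (v ≟ w)

fourth-matching : ∀ s t w → s ≢ t → w ≢ s → w ≢ t →
  fourth s t w ≢ s × fourth s t w ≢ t × fourth s t w ≢ w × fourth s t (fourth s t w) ≡ w
fourth-matching = toWitness {a? = all? λ s → all? λ t → all? λ w →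
  ¬? (s ≟ t) →-dec ¬? (w ≟ s) →-dec ¬? (w ≟ t) →-dec
  ¬? (fourth s t w ≟ s) ×-dec ¬? (fourth s t w ≟ t) ×-dec ¬? (fourth s t w ≟ w) ×-dec fourth s t (fourth s t w) ≟ w} tt

complete₄⇒brick′ : (μ : Fin 4 → Fin 4 → ℕ) → (∀ u v → u ≢ v → 1 ≤ μ u v) → Brick′ (graph 4 μ)
complete₄⇒brick′ μ adj = connected , s≤s (s≤s (s≤s (s≤s z≤n))) , λ s t s≢t → fourth s t , matched s t s≢t
  where
  connected : ConnectedMinus₂ (graph 4 μ)
  connected a b u v _ _ v≢a v≢b with u ≟ v
  ... | yes refl = here
  ... | no u≢v   = step (adj u v u≢v) v≢a v≢b here
  matched : ∀ s t → s ≢ t → ∀ w → w ≢ s → w ≢ t →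
    (fourth s t w ≢ s) × (fourth s t w ≢ t) × (fourth s t w ≢ w) × (fourth s t (fourth s t w) ≡ w) × Adjacent (graph 4 μ) w (fourth s t w)
  matched s t s≢t w w≢s w≢t with fourth-matching s t w s≢t w≢s w≢t
  ... | ≢s , ≢t , ≢w , inv = ≢s , ≢t , ≢w , inv , adj w _ (≢w ∘ sym)

K4-isGraph : IsGraph K4
K4-isGraph = record { symmetric = λ u v → nind-cong (u ≟ v) (v ≟ u) sym sym ; loopless = λ v → nind-yes (v ≟ v) refl }

K4-cubic : Cubic K4
K4-cubic zero                   = refl
K4-cubic (suc zero)             = refl
K4-cubic (suc (suc zero))       = refl
K4-cubic (suc (suc (suc zero))) = refl

K4-simple : Simple K4
K4-simple u v = nind≤1 (u ≟ v)

K4-brick′ : Brick′ K4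
K4-brick′ = complete₄⇒brick′ _ λ u v u≢v → ≤-reflexive (sym (nind-no (u ≟ v) u≢v))

K4-noDiamondAvoiding : ∀ x → NoDiamondAvoiding K4 x
K4-noDiamondAvoiding x (triangle a b c a≢b b≢c a≢c _ _ _) d u v a≢x b≢x c≢x d≢x d∉T _ _ _ _ _ =
  no-five-distinct x a b c d a≢x b≢x c≢x d≢x a≢b b≢c a≢c (d∉T ∘ inj₁) (d∉T ∘ inj₂ ∘ inj₁) (d∉T ∘ inj₂ ∘ inj₂)

-- K4 with a triangle contracted
Θ : Graph
Θ = graph 2 (λ u v → nind (u ≟ v) * 3)

Θ-isGraph : IsGraph Θ
Θ-isGraph = record { symmetric = λ u v → cong (_* 3) (nind-cong (u ≟ v) (v ≟ u) sym sym)
                   ; loopless  = λ v → cong (_* 3) (nind-yes (v ≟ v) refl) }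

Θ-cubic : Cubic Θ
Θ-cubic zero       = refl
Θ-cubic (suc zero) = refl

toΘ : Fin 4 → Fin 4 → Fin 2
toΘ x u = ifDec (u ≟ x) (suc zero) zero

toΘ-≢ : ∀ x {u} → u ≢ x → toΘ x u ≡ zero
toΘ-≢ x {u} = ifDec-no (u ≟ x)

K4-contraction : ∀ x (T : Triangle K4) → Triangle.a T ≢ x → Triangle.b T ≢ x → Triangle.c T ≢ x → Contraction K4 T Θ
K4-contraction x T@(triangle a b c a≢b b≢c a≢c _ _ _) a≢x b≢x c≢x = record
  { f       = toΘ x
  ; onto    = onto
  ; fibres  = λ u v → fibres⁻ u v , fibres⁺ u v
  ; edges   = edges x
  ; noLoops = λ { zero → refl ; (suc zero) → refl }
  }
  where
  inT⇒≢x : ∀ {u} → InT T u → u ≢ x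
  inT⇒≢x (inj₁ refl)        = a≢x
  inT⇒≢x (inj₂ (inj₁ refl)) = b≢x
  inT⇒≢x (inj₂ (inj₂ refl)) = c≢x
  onto : ∀ q → ∃[ u ] (∀ {z} → z ≡ u → toΘ x z ≡ q)
  onto zero       = a , λ { refl → toΘ-≢ x a≢x }
  onto (suc zero) = x , λ { refl → ifDec-yes (x ≟ x) refl }
  fibres⁻ : ∀ u v → toΘ x u ≡ toΘ x v → u ≡ v ⊎ (InT T u × InT T v)
  fibres⁻ u v e with u ≟ x | v ≟ x | e
  ... | yes refl | yes refl | _ = inj₁ refl
  ... | no u≢x   | no v≢x   | _ = inj₂ (four-cover x a b c u a≢x b≢x c≢x u≢x a≢b b≢c a≢c ,
                                      four-cover x a b c v a≢x b≢x c≢x v≢x a≢b b≢c a≢c)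
  fibres⁺ : ∀ u v → u ≡ v ⊎ (InT T u × InT T v) → toΘ x u ≡ toΘ x v
  fibres⁺ u v (inj₁ refl)       = refl
  fibres⁺ u v (inj₂ (u∈ , v∈)) = trans (toΘ-≢ x (inT⇒≢x u∈)) (sym (toΘ-≢ x (inT⇒≢x v∈)))
  edges : ∀ x p q → p ≢ q → mult Θ p q ≡ Σfin 4 (λ u → Σfin 4 (λ v → ind (toΘ x u ≟ p) * ind (toΘ x v ≟ q) * mult K4 u v))
  edges _ zero zero p≢q             = contradiction refl p≢q
  edges _ (suc zero) (suc zero) p≢q = contradiction refl p≢q
  edges zero                   zero (suc zero) _ = refl
  edges zero                   (suc zero) zero _ = refl
  edges (suc zero)             zero (suc zero) _ = refl
  edges (suc zero)             (suc zero) zero _ = refl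
  edges (suc (suc zero))       zero (suc zero) _ = refl
  edges (suc (suc zero))       (suc zero) zero _ = refl
  edges (suc (suc (suc zero))) zero (suc zero) _ = refl
  edges (suc (suc (suc zero))) (suc zero) zero _ = refl

-- Expanding the vertex of Θ that carries the contracted triangle gives K4 back.
Θ-YΔ-brick′ : ∀ (y : Fin 3 → Fin 2) → (∀ i → y i ≡ zero) → Brick′ (YΔ Θ (suc zero) y)
Θ-YΔ-brick′ y y≡0 = complete₄⇒brick′ _ adj
  where
  corner : ∀ i → 1 ≤ ind (y i ≟ zero)
  corner i = ≤-reflexive (sym (ind-yes (y i ≟ zero) (y≡0 i)))
  adj : ∀ u v → u ≢ v → 1 ≤ roleMult Θ y (role (suc zero) u) (role (suc zero) v)
  adj zero zero u≢v = contradiction refl u≢v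
  adj (suc zero) (suc zero) u≢v = contradiction refl u≢v
  adj (suc (suc zero)) (suc (suc zero)) u≢v = contradiction refl u≢v
  adj (suc (suc (suc zero))) (suc (suc (suc zero))) u≢v = contradiction refl u≢v
  adj zero (suc zero) _ = corner zero
  adj zero (suc (suc zero)) _ = corner (suc zero)
  adj zero (suc (suc (suc zero))) _ = corner (suc (suc zero))
  adj (suc zero) zero _ = corner zero
  adj (suc (suc zero)) zero _ = corner (suc zero)
  adj (suc (suc (suc zero))) zero _ = corner (suc (suc zero))
  adj (suc zero) (suc (suc zero)) _ = s≤s z≤n
  adj (suc zero) (suc (suc (suc zero))) _ = s≤s z≤n
  adj (suc (suc zero)) (suc zero) _ = s≤s z≤n
  adj (suc (suc zero)) (suc (suc (suc zero))) _ = s≤s z≤n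
  adj (suc (suc (suc zero))) (suc zero) _ = s≤s z≤n
  adj (suc (suc (suc zero))) (suc (suc zero)) _ = s≤s z≤n

TrianglesContractToCubicBricks : Graph → Set
TrianglesContractToCubicBricks G = ∀ (T : Triangle G) → ∃[ K ] Contraction G T K × Cubic K × Brick′ K

record Invariant (G : Graph) : Set where
  field
    isGraph   : IsGraph G
    cubic     : Cubic G
    simple    : Simple G
    brick′    : Brick′ G
    noDiamond : NoDiamond G
    triangles : TrianglesContractToCubicBricks G

OldTrianglesContractToCubicBricks : ∀ G (x : Fin (size G)) (y : Fin 3 → Fin (size G)) → Set
OldTrianglesContractToCubicBricks G x y = ∀ (T : Triangle (YΔ G x y)) a₀ b₀ c₀ →
  role x (Triangle.a T) ≡ old a₀ → role x (Triangle.b T) ≡ old b₀ → role x (Triangle.c T) ≡ old c₀ →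
  ∃[ K ] Contraction (YΔ G x y) T K × Cubic K × Brick′ K

YΔ-invariant : ∀ G x y → IsGraph G → Cubic G → Simple G → Brick′ G → (nbrs : Nbrs G x y) →
  NoDiamondAvoiding G x → OldTrianglesContractToCubicBricks G x y → Invariant (YΔ G x y)
YΔ-invariant G x y isG cubicG simpleG (connG , bicG) nbrs noDiamondG oldTriangles = record
  { isGraph   = isGraph
  ; cubic     = cubic cubicG
  ; simple    = simple simpleG
  ; brick′    = YΔ-Connectivity.connectedMinus₂ G x y isG nbrs y-injective connG , YΔ-Bicritical.bicritical G x y isG nbrs bicG
  ; noDiamond = noDiamond noDiamondG
  ; triangles = triangles
  }
  where
  open YΔ-Roles G x y
  open Properties isG nbrs
  y-injective = countY≤1⇒injective y (λ v → subst (_≤ 1) (nbrs v) (simpleG x v))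
  open YΔ-Triangles G x y isG nbrs y-injective
  triangles : TrianglesContractToCubicBricks (YΔ G x y)
  triangles T with classify T
  ... | inj₁ (a₀ , b₀ , c₀ , ea , eb , ec) = oldTriangles T a₀ b₀ c₀ ea eb ec
  ... | inj₂ (i , j , k , ea , eb , ec)    = G , NewTriangle.contraction T i j k ea eb ec , cubicG , connG , bicG

invariant : ∀ {G} → YΔ⁺ K4 G → Invariant G
invariant (one x y nbrs) =
  YΔ-invariant K4 x y K4-isGraph K4-cubic K4-simple K4-brick′ nbrs (K4-noDiamondAvoiding x) oldTriangles
  where
  y-injective = countY≤1⇒injective y (λ v → subst (_≤ 1) (nbrs v) (K4-simple x v))
  oldTriangles : OldTrianglesContractToCubicBricks K4 x y
  oldTriangles T a₀ b₀ c₀ ea eb ec = YΔ Θ x′ y′ , contraction , YΔ-Roles.Properties.cubic Θ x′ y′ Θ-isGraph nbrs′ Θ-cubic ,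
    subst (λ z → Brick′ (YΔ Θ z y′)) (sym (ifDec-yes (x ≟ x) refl)) (Θ-YΔ-brick′ y′ (λ i → toΘ-≢ x (y≢x i)))
    where
    open YΔ-Roles.Properties K4 x y K4-isGraph nbrs using (y≢x)
    open YΔ-Triangles.OldTriangle K4 x y K4-isGraph nbrs y-injective T a₀ b₀ c₀ ea eb ec
    open Contract Θ (K4-contraction x T₀ a₀≢x b₀≢x c₀≢x)
invariant (more {G} x y chain nbrs) =
  YΔ-invariant G x y isGraph cubic simple brick′ nbrs (λ T d u v _ _ _ _ → noDiamond T d u v) oldTriangles
  where
  open Invariant (invariant chain)
  y-injective = countY≤1⇒injective y (λ v → subst (_≤ 1) (nbrs v) (simple x v))
  oldTriangles : OldTrianglesContractToCubicBricks G x y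
  oldTriangles T a₀ b₀ c₀ ea eb ec = expand (triangles T₀)
    where
    open YΔ-Triangles.OldTriangle G x y isGraph nbrs y-injective T a₀ b₀ c₀ ea eb ec
    expand : ∃[ K ] Contraction G T₀ K × Cubic K × Brick′ K → ∃[ K ] Contraction (YΔ G x y) T K × Cubic K × Brick′ K
    expand (K , C , cubicK , connK , bicK) =
      YΔ K x′ y′ , contraction , YΔ-Roles.Properties.cubic K x′ y′ isK nbrs′ cubicK ,
      YΔ-Connectivity.connectedMinus₂ K x′ y′ isK nbrs′ (y′-injective noDiamond) connK ,
      YΔ-Bicritical.bicritical K x′ y′ isK nbrs′ bicK
      where
      isK = contraction-isGraph isGraph C
      open Contract K C

proposition1 : (G : Graph) → IsGraph G → ¬ (G ≅ K4) → IsBase K4 G →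
    (T : Triangle G) →
    Σ Graph (Contraction G T) × (∀ H → Contraction G T H → Cubic H × Brick H)
proposition1 G _ _ (G′ , chain , σ) T = (K , G/T) , λ H C → cubic H C , brick H C
  where
  open ≅-Transport {G} {G′} σ using (triangle′; contraction)
  K/T′ : ∃[ K ] Contraction G′ (triangle′ T) K × Cubic K × Brick′ K
  K/T′ = Invariant.triangles (invariant chain) (triangle′ T)
  K : Graph
  K = proj₁ K/T′
  G/T : Contraction G T K
  G/T = contraction (proj₁ (proj₂ K/T′))
  cubic : ∀ H → Contraction G T H → Cubic H
  cubic H C = ≅-Transport.cubic {H} {K} (contraction-unique C G/T) (proj₁ (proj₂ (proj₂ K/T′)))
  brick : ∀ H → Contraction G T H → Brick H
  brick H C = brick′⇒brick H (≅-Transport.brick′ {H} {K} (contraction-unique C G/T) (proj₂ (proj₂ (proj₂ K/T′))))
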